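{- Let $w\in S_n$ with $w\ne\mathrm{id}$, and let $\mathbf{b}_w$ be the Rothe bumpless pipe dream of $w$. Then there is a $2\times2$ flip applicable to $\mathbf{b}_w$ which removes a cross tile and produces a reduced bumpless pipe dream whose boundary permutation $w'$ satisfies $\ell(w')=\ell(w)-1$.
   Context: Cells of the $n\times n$ grid are indexed $(i,j)$, row $i$ top to bottom, column $j$ left to right. A bumpless pipe dream (BPD) is a tiling of the grid by the tiles empty, cross, horizontal (west–east segment), vertical (south–north), r-elbow (joining south and east edge midpoints), j-elbow (joining north and west), such that segments match across adjacent cells, no segment touches the north or west boundary, and every edge on the south and east boundary carries a segment. This yields $n$ pipes, each entering from the south boundary and traveling north/east to exit on the east boundary. The boundary permutation $w$ is defined by: the pipe exiting the east boundary at row $i$ entered from the south boundary at column $w(i)$. A BPD is reduced if each pair of pipes crosses at most once (equivalently, the number of cross tiles equals $\ell(w)$, the number of inversions of $w$). The Rothe diagram is $D(w)=\{(i,j): w(i)>j,\ w^{ -1}(j)>i\}$. The Rothe BPD $\mathbf{b}_w$ has, for each $i$, a pipe running vertically up column $w(i)$ from the south boundary to cell $(i,w(i))$, an r-elbow at $(i,w(i))$, and then running horizontally east to the boundary; cells where two such pipes meet are crosses and the cells of $D(w)$ are empty. It is reduced with boundary permutation $w$. The height function of a BPD $D$ on $0\le a,b\le n$: $h_D(a,0)=0$ and for $b\ge1$, $h_D(a,b)$ is the number of $j\le a$ such that the south edge of cell $(b,j)$ carries a segment. A $2\times 2$ flip at an interior vertex $(a,b)$, $1\le a,b\le n-1$,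 replaces the tiles of the four cells meeting at the grid point between rows $b,b+1$ and columns $a,a+1$ by another tiling so that the result is again a BPD whose height function differs from the original only at $(a,b)$, by $\pm1$. -}

module Defs where

open import Data.Nat using (ℕ; zero; suc; _+_; _∸_; _*_; _≤_; _<_; _<ᵇ_; _≡ᵇ_)
open import Data.Bool using (Bool; true; false; if_then_else_; _∧_; _∨_; not)
open import Data.Fin using (Fin; toℕ)
import Data.Fin as F
open import Data.Maybe using (Maybe; just; nothing)
import Data.Maybe as M
open import Data.Product using (_×_; _,_; ∃-syntax)
open import Data.Sum using (_⊎_)
open import Relation.Nullary using (¬_)
open import Relation.Binary.PropositionalEquality using (_≡_)
open import Data.Fin.Permutation using (Permutation′; _⟨$⟩ʳ_; _⟨$⟩ˡ_)

data Tile : Set where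
  empty cross horiz vert relbow jelbow : Tile

segN segS segE segW : Tile → Bool
segN cross = true
segN vert = true
segN jelbow = true
segN _ = false
segS cross = true
segS vert = true
segS relbow = true
segS _ = false
segE cross = true
segE horiz = true
segE relbow = true
segE _ = false
segW cross = true
segW horiz = true
segW jelbow = true
segW _ = false

isCross : Tile → Bool
isCross cross = true
isCross _ = false

-- A tiling of the n×n grid: Grid n i j is the tile in row i (top to
-- bottom), column j (left to right), 0-indexed.
Grid : ℕ → Set
Grid n = Fin n → Fin n → Tile

idx : (n : ℕ) → ℕ → Maybe (Fin n)
idx zero _ = nothing
idx (suc n) zero = just F.zero
idx (suc n) (suc k) = M.map F.suc (idx n k)

-- tile at 0-indexed (row, col); out of range cells are treated as empty
tileAt : ∀ {n} → Grid n → ℕ → ℕ → Tile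
tileAt {n} D i j with idx n i | idx n j
... | just i' | just j' = D i' j'
... | _ | _ = empty

record IsBPD {n : ℕ} (D : Grid n) : Set where
  field
    matchH : ∀ i j → i < n → suc j < n →
             segE (tileAt D i j) ≡ segW (tileAt D i (suc j))
    matchV : ∀ i j → suc i < n → j < n →
             segS (tileAt D i j) ≡ segN (tileAt D (suc i) j)
    northB : ∀ j → j < n → segN (tileAt D 0 j) ≡ false
    westB  : ∀ i → i < n → segW (tileAt D i 0) ≡ false
    southB : ∀ j → j < n → segS (tileAt D (n ∸ 1) j) ≡ true
    eastB  : ∀ i → i < n → segE (tileAt D i (n ∸ 1)) ≡ true

-- Pipe tracing.  A pipe enters a cell from the south or from the west
-- and leaves to the north or to the east.
data In : Set where
  fromS fromW : In

data Out : Set where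
  toN toE : Out

step : Tile → In → Maybe Out
step cross fromS = just toN
step cross fromW = just toE
step vert fromS = just toN
step horiz fromW = just toE
step relbow fromS = just toE
step jelbow fromW = just toN
step _ _ = nothing

-- follow a pipe (fuel-bounded); returns the row at which it exits the
-- east boundary, or nothing if the tiling is inconsistent along the way
follow : ∀ {n} → Grid n → ℕ → ℕ → ℕ → In → Maybe ℕ
follow D zero r c d = nothing
follow {n} D (suc f) r c d with step (tileAt D r c) d
... | nothing = nothing
... | just toN with r
...   | zero = nothing
...   | suc r' = follow D f r' c fromS
follow {n} D (suc f) r c d | just toE =
  if suc c ≡ᵇ n then just r else follow D f r (suc c) fromW

exitRow : ∀ {n} → Grid n → ℕ → Maybe ℕ
exitRow {n} D c = follow D (2 * n) (n ∸ 1) c fromS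

-- boundary permutation: the pipe exiting at row i entered at column w(i)
HasBoundaryPerm : ∀ {n} → Grid n → Permutation′ n → Set
HasBoundaryPerm {n} D w = ∀ i → exitRow D (toℕ (w ⟨$⟩ʳ i)) ≡ just (toℕ i)

sumFin : ∀ n → (Fin n → ℕ) → ℕ
sumFin zero f = 0
sumFin (suc n) f = f F.zero + sumFin n (λ i → f (F.suc i))

b2n : Bool → ℕ
b2n true = 1
b2n false = 0

inv : ∀ {n} → Permutation′ n → ℕ
inv {n} w = sumFin n λ i → sumFin n λ j →
  b2n ((toℕ i <ᵇ toℕ j) ∧ (toℕ (w ⟨$⟩ʳ j) <ᵇ toℕ (w ⟨$⟩ʳ i)))

numCross : ∀ {n} → Grid n → ℕ
numCross {n} D = sumFin n λ i → sumFin n λ j → b2n (isCross (D i j))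

Reduced : ∀ {n} → Grid n → Permutation′ n → Set
Reduced D w = numCross D ≡ inv w

rothe : ∀ {n} → Permutation′ n → Grid n
rothe w i j =
  let wi = toℕ (w ⟨$⟩ʳ i)
      jj = toℕ j
      hor = wi <ᵇ jj
      ver = toℕ (w ⟨$⟩ˡ j) <ᵇ toℕ i            -- w⁻¹(j) < i (pipe below its elbow)
  in if jj ≡ᵇ wi then relbow
     else if hor ∧ ver then cross
     else if hor then horiz
     else if ver then vert
     else empty

countBelow : ℕ → (ℕ → Bool) → ℕ
countBelow zero p = 0
countBelow (suc k) p = countBelow k p + b2n (p k)

-- height function h_D(a,b), 0 ≤ a,b ≤ n (a = column, b = row of vertex)
height : ∀ {n} → Grid n → ℕ → ℕ → ℕ
height D a zero = 0
height D a (suc b) = countBelow a (λ j → segS (tileAt D b j))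

-- 0-indexed cell (i,j) is one of the four cells around interior vertex (a,b)
InBlock : ℕ → ℕ → ℕ → ℕ → Set
InBlock a b i j = (suc i ≡ b ⊎ i ≡ b) × (suc j ≡ a ⊎ j ≡ a)

IsFlip : ∀ {n} → Grid n → Grid n → ℕ → ℕ → Set
IsFlip {n} D D' a b =
  (1 ≤ a) × (suc a ≤ n) × (1 ≤ b) × (suc b ≤ n) ×
  IsBPD D' ×
  (∀ i j → ¬ InBlock a b (toℕ i) (toℕ j) → D' i j ≡ D i j) ×
  (∀ a' b' → a' ≤ n → b' ≤ n → ¬ (a' ≡ a × b' ≡ b) →
     height D' a' b' ≡ height D a' b') ×
  (height D' a b ≡ suc (height D a b) ⊎ height D a b ≡ suc (height D' a b))

RemovesCross : ∀ {n} → Grid n → Grid n → ℕ → ℕ → Set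
RemovesCross {n} D D' a b =
  ∃[ i ] ∃[ j ] (InBlock a b (toℕ i) (toℕ j) × D i j ≡ cross × ¬ (D' i j ≡ cross))

-- Let i₀ be the first descent of w and j₁ the first column right of w (i₀ + 1)
-- whose pipe has its elbow in a row r ≤ i₀ (rows and columns 0-indexed).  In
-- the Rothe BPD the 2×2 block in rows i₀, i₀ + 1 and columns j₁ − 1, j₁ has an
-- empty top left cell and a cross in its bottom right cell, where the pipes of
-- rows r and i₀ + 1 meet.  Replacing the cross by elbows sends the pipe of
-- column w (i₀ + 1) up through the top left cell onto the old route of pipe r,
-- and the pipe of column j₁ into row i₀ + 1; all other pipes keep their route.
-- So the new boundary permutation is w ∘ (r i₀+1), and by the choice of j₁ no
-- row strictly between r and i₀ + 1 has its value between w (i₀ + 1) and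
-- w r = j₁: the transposition removes exactly one inversion, matching the one
-- cross removed.  Only the south segments of row i₀ change, by moving one from
-- column j₁ to column j₁ − 1, so the height function changes only at the
-- vertex (j₁, i₀ + 1), by one.

module Submission where

open import Defs
open import Data.Nat
  using (ℕ; zero; suc; _+_; _∸_; _*_; _≤_; _<_; _<ᵇ_; _≡ᵇ_; _≤ᵇ_; z≤n; s≤s; z<s; _≟_; _<?_; _≤?_)
open import Data.Nat.Properties hiding (_≟_)
open import Data.Bool using (Bool; true; false; if_then_else_; _∧_; _∨_; not)
open import Data.Bool.Properties using (∧-assoc; ∧-comm; ∧-zeroʳ)
open import Data.Fin using (Fin; toℕ; fromℕ<)
import Data.Fin as F
import Data.Fin.Properties as FP
open import Data.Maybe using (just)
import Data.Maybe as M
open import Data.Product using (_×_; _,_; ∃-syntax; proj₁; proj₂)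
open import Data.Sum using (_⊎_; inj₁; inj₂; [_,_]′)
open import Relation.Nullary using (¬_; Dec; yes; no; contradiction)
open import Relation.Nullary.Decidable using (_×-dec_; dec-true; dec-false; does-⇔)
open import Function.Bundles using (mk⇔)
open import Relation.Binary.PropositionalEquality
open import Function using (_∘_)
open import Relation.Binary.Definitions using (tri<; tri≈; tri>)
open import Data.Fin.Permutation
  using (Permutation′; _⟨$⟩ʳ_; _⟨$⟩ˡ_; inverseˡ; inverseʳ; flip; transpose; _∘ₚ_)
import Data.Fin.Permutation.Components as PC
open import Data.Vec.Functional using (updateAt)
open import Data.Vec.Functional.Properties using (updateAt-updates; updateAt-minimal)
import Algebra.Properties.CommutativeMonoid.Sum as CommutativeMonoidSum
open import Data.Nat.Tactic.RingSolver using (solve-∀)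

<⇒<ᵇ≡true : ∀ {m n} → m < n → (m <ᵇ n) ≡ true
<⇒<ᵇ≡true {m} {n} = dec-true (m <? n)

≮⇒<ᵇ≡false : ∀ {m n} → ¬ m < n → (m <ᵇ n) ≡ false
≮⇒<ᵇ≡false {m} {n} = dec-false (m <? n)

step-S→N : ∀ t → segS t ≡ true → segN t ≡ true → step t fromS ≡ just toN
step-S→N cross _ _ = refl
step-S→N vert _ _ = refl
step-S→N empty () _
step-S→N horiz () _
step-S→N relbow _ ()
step-S→N jelbow () _

step-S→E : ∀ t → segS t ≡ true → segN t ≡ false → step t fromS ≡ just toE
step-S→E relbow _ _ = refl
step-S→E cross _ ()
step-S→E vert _ ()
step-S→E empty () _
step-S→E horiz () _
step-S→E jelbow () _

step-W→E : ∀ t → segW t ≡ true → segE t ≡ true → step t fromW ≡ just toE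
step-W→E cross _ _ = refl
step-W→E horiz _ _ = refl
step-W→E empty () _
step-W→E vert () _
step-W→E relbow () _
step-W→E jelbow _ ()

step-W→N : ∀ t → segW t ≡ true → segE t ≡ false → step t fromW ≡ just toN
step-W→N jelbow _ _ = refl
step-W→N cross _ ()
step-W→N horiz _ ()
step-W→N empty () _
step-W→N vert () _
step-W→N relbow () _

<⇒≤∸1 : ∀ {m n} → m < n → m ≤ n ∸ 1
<⇒≤∸1 (s≤s m≤n) = m≤n

m<n⇒n∸1<n : ∀ {m n} → m < n → n ∸ 1 < n
m<n⇒n∸1<n {n = suc n} _ = n<1+n n

isCross⇒≡cross : ∀ t → isCross t ≡ true → t ≡ cross
isCross⇒≡cross cross _ = refl
isCross⇒≡cross empty ()
isCross⇒≡cross horiz ()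
isCross⇒≡cross vert ()
isCross⇒≡cross relbow ()
isCross⇒≡cross jelbow ()

idx-toℕ : ∀ n (i : Fin n) → idx n (toℕ i) ≡ just i
idx-toℕ (suc n) F.zero = refl
idx-toℕ (suc n) (F.suc i) rewrite idx-toℕ n i = refl

toℕ≡⇒≡fromℕ< : ∀ {n} {x : Fin n} {y} (y<n : y < n) → toℕ x ≡ y → x ≡ fromℕ< y<n
toℕ≡⇒≡fromℕ< y<n e = FP.toℕ-injective (trans e (sym (FP.toℕ-fromℕ< y<n)))

tileAt-toℕ : ∀ {n} (D : Grid n) (i j : Fin n) → tileAt D (toℕ i) (toℕ j) ≡ D i j
tileAt-toℕ {n} D i j rewrite idx-toℕ n i | idx-toℕ n j = refl

tileAt-∀ : ∀ {n} (D : Grid n) (P : ℕ → ℕ → Tile → Set) →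
  (∀ i j → P (toℕ i) (toℕ j) (D i j)) → ∀ i j → i < n → j < n → P i j (tileAt D i j)
tileAt-∀ D P h i j i<n j<n =
  subst₂ (λ a b → P a b (tileAt D a b)) (FP.toℕ-fromℕ< i<n) (FP.toℕ-fromℕ< j<n)
    (subst (P _ _) (sym (tileAt-toℕ D _ _)) (h _ _))

fromAbove : (ℕ → ℕ → Bool) → ℕ → ℕ → Bool
fromAbove V zero j = false
fromAbove V (suc i) j = V i j

fromLeft : (ℕ → ℕ → Bool) → ℕ → ℕ → Bool
fromLeft H i zero = false
fromLeft H i (suc j) = H i j

record Segments {n : ℕ} (D : Grid n) (H V : ℕ → ℕ → Bool) : Set where
  field
    east  : ∀ i j → i < n → j < n → segE (tileAt D i j) ≡ H i j
    south : ∀ i j → i < n → j < n → segS (tileAt D i j) ≡ V i j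
    north : ∀ i j → i < n → j < n → segN (tileAt D i j) ≡ fromAbove V i j
    west  : ∀ i j → i < n → j < n → segW (tileAt D i j) ≡ fromLeft H i j

segments-isBPD : ∀ {n} {D : Grid n} {H V} → Segments D H V →
  (∀ j → j < n → V (n ∸ 1) j ≡ true) → (∀ i → i < n → H i (n ∸ 1) ≡ true) → IsBPD D
segments-isBPD {n} S bottom right = record
  { matchH = λ i j i<n j<n → trans (east i j i<n (<-trans (n<1+n j) j<n)) (sym (west i (suc j) i<n j<n))
  ; matchV = λ i j i<n j<n → trans (south i j (<-trans (n<1+n i) i<n) j<n) (sym (north (suc i) j i<n j<n))
  ; northB = λ j j<n → north 0 j (<-≤-trans z<s j<n) j<n
  ; westB  = λ i i<n → west i 0 i<n (<-≤-trans z<s i<n)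
  ; southB = λ j j<n → trans (south (n ∸ 1) j (m<n⇒n∸1<n j<n) j<n) (bottom j j<n)
  ; eastB  = λ i i<n → trans (east i (n ∸ 1) i<n (m<n⇒n∸1<n i<n)) (right i i<n) }
  where open Segments S

countBelow-cong : ∀ a {f g : ℕ → Bool} → (∀ j → j < a → f j ≡ g j) → countBelow a f ≡ countBelow a g
countBelow-cong zero _ = refl
countBelow-cong (suc a) f≡g =
  cong₂ _+_ (countBelow-cong a (λ j j<a → f≡g j (<-trans j<a (n<1+n a)))) (cong b2n (f≡g a (n<1+n a)))

height-segments : ∀ {n} {D : Grid n} {H V} → Segments D H V →
  ∀ a b → a ≤ n → b < n → height D a (suc b) ≡ countBelow a (V b)
height-segments S a b a≤n b<n = countBelow-cong a (λ j j<a → Segments.south S b j b<n (<-≤-trans j<a a≤n))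

-- Tracing pipes

module Tracing {n : ℕ} (D : Grid n) {H V : ℕ → ℕ → Bool} (S : Segments D H V) where
  open Segments S

  -- Every step goes north or east, so r + (n ∸ c) units of fuel carry the
  -- pipe entering cell (r, c) to the east boundary.
  Reach : ℕ → ℕ → In → ℕ → Set
  Reach r c d x = ∀ f → r + (n ∸ c) ≤ f → follow D f r c d ≡ just x

  reach-north : ∀ {i j d x} → step (tileAt D (suc i) j) d ≡ just toN →
    Reach i j fromS x → Reach (suc i) j d x
  reach-north st R zero ()
  reach-north st R (suc f) (s≤s le) rewrite st = R f le

  reach-east : ∀ {i j d x} → j < n → step (tileAt D i j) d ≡ just toE →
    (suc j ≡ n → x ≡ i) → (suc j < n → Reach i (suc j) fromW x) → Reach i j d x
  reach-east {i} {j} j<n st exit continue zero le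
    rewrite +-∸-assoc 1 j<n | +-suc i (n ∸ suc j) with () ← le
  reach-east {i} {j} j<n st exit continue (suc f) le rewrite st with suc j ≟ n
  ... | yes e rewrite dec-true (suc j ≟ n) e = cong just (sym (exit e))
  ... | no e rewrite dec-false (suc j ≟ n) e =
    continue (≤∧≢⇒< j<n e) f (≤-pred (subst (_≤ suc f) (trans (cong (i +_) (+-∸-assoc 1 j<n)) (+-suc i _)) le))

  reach-up : ∀ {i j x} → suc i < n → j < n → V (suc i) j ≡ true → V i j ≡ true →
    Reach i j fromS x → Reach (suc i) j fromS x
  reach-up {i} {j} i<n j<n below above =
    reach-north (step-S→N _ (trans (south (suc i) j i<n j<n) below) (trans (north (suc i) j i<n j<n) above))

  reach-column : ∀ {x y c z} → x ≤ y → y < n → c < n →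
    (∀ s → x ≤ s → s ≤ y → V s c ≡ true) → Reach x c fromS z → Reach y c fromS z
  reach-column {y = zero} z≤n _ _ _ R = R
  reach-column {x} {suc y} x≤y y<n c<n col R with m≤n⇒m<n∨m≡n x≤y
  ... | inj₂ refl = R
  ... | inj₁ (s≤s x≤y′) =
    reach-up y<n c<n (col (suc y) x≤y ≤-refl) (col y x≤y′ (n≤1+n y))
      (reach-column x≤y′ (<-trans (n<1+n y) y<n) c<n (λ s a b → col s a (m≤n⇒m≤1+n b)) R)

  reach-turn-north : ∀ {i j x} → suc i < n → j < n → fromLeft H (suc i) j ≡ true → H (suc i) j ≡ false →
    Reach i j fromS x → Reach (suc i) j fromW x
  reach-turn-north {i} {j} i<n j<n left ¬right =
    reach-north (step-W→N _ (trans (west (suc i) j i<n j<n) left) (trans (east (suc i) j i<n j<n) ¬right))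

  reach-turn-east : ∀ {i j x} → i < n → suc j < n → V i j ≡ true → fromAbove V i j ≡ false →
    Reach i (suc j) fromW x → Reach i j fromS x
  reach-turn-east {i} {j} i<n j<n below ¬above R =
    reach-east j<n′ (step-S→E _ (trans (south i j i<n j<n′) below) (trans (north i j i<n j<n′) ¬above))
      (λ e → contradiction e (<⇒≢ j<n)) (λ _ → R)
    where j<n′ = <-trans (n<1+n j) j<n

  reach-right : ∀ {i j x} → i < n → suc j < n → fromLeft H i j ≡ true → H i j ≡ true →
    Reach i (suc j) fromW x → Reach i j fromW x
  reach-right {i} {j} i<n j<n left right R =
    reach-east j<n′ (step-W→E _ (trans (west i j i<n j<n′) left) (trans (east i j i<n j<n′) right))
      (λ e → contradiction e (<⇒≢ j<n)) (λ _ → R)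
    where j<n′ = <-trans (n<1+n j) j<n

  reach-row : ∀ {i j k x} → i < n → j ≤ k → k < n →
    (∀ t → j ≤ t → t < k → fromLeft H i t ≡ true × H i t ≡ true) →
    Reach i k fromW x → Reach i j fromW x
  reach-row {k = zero} _ z≤n _ _ R = R
  reach-row {i} {j} {suc k} i<n j≤k k<n row R with m≤n⇒m<n∨m≡n j≤k
  ... | inj₂ refl = R
  ... | inj₁ (s≤s j≤k′) =
    reach-row i<n j≤k′ (<-trans (n<1+n k) k<n) (λ t a b → row t a (m≤n⇒m≤1+n b))
      (reach-right i<n k<n (proj₁ (row k j≤k′ ≤-refl)) (proj₂ (row k j≤k′ ≤-refl)) R)

  reach-row-exit : ∀ {i j} → i < n → j < n →
    (∀ t → j ≤ t → t < n → fromLeft H i t ≡ true × H i t ≡ true) → Reach i j fromW i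
  reach-row-exit {i} {j} i<n j<n row =
    reach-row i<n (<⇒≤∸1 j<n) last<n (λ t a b → row t a (<-trans b last<n))
      (reach-east last<n (step-W→E _ (trans (west i last i<n last<n) (proj₁ at-last))
                                    (trans (east i last i<n last<n) (proj₂ at-last)))
        (λ _ → refl) (λ lt → contradiction (<⇒≤∸1 lt) (<⇒≱ (n<1+n last))))
    where
    last = n ∸ 1
    last<n : last < n
    last<n = m<n⇒n∸1<n j<n
    at-last : fromLeft H i last ≡ true × H i last ≡ true
    at-last = row last (<⇒≤∸1 j<n) last<n

  reach-corner-exit : ∀ {i j} → i < n → j < n → V i j ≡ true → fromAbove V i j ≡ false →
    (∀ t → j ≤ t → t < n → H i t ≡ true) → Reach i j fromS i
  reach-corner-exit {i} {j} i<n j<n below ¬above right =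
    reach-east j<n (step-S→E _ (trans (south i j i<n j<n) below) (trans (north i j i<n j<n) ¬above))
      (λ _ → refl)
      (λ j+1<n → reach-row-exit i<n j+1<n
        (λ { zero () _ ; (suc t) (s≤s j≤t) t<n →
               right t j≤t (<-trans (n<1+n t) t<n) , right (suc t) (m≤n⇒m≤1+n j≤t) t<n }))

  exitRow-reach : ∀ {c x} → Reach (n ∸ 1) c fromS x → exitRow D c ≡ just x
  exitRow-reach {c} R = R (2 * n) (+-mono-≤ (m∸n≤m n 1) (≤-trans (m∸n≤m n c) (m≤m+n n 0)))

-- Sums over Fin

module ℕ-Sum = CommutativeMonoidSum +-0-commutativeMonoid

sumFin≡sum : ∀ n (f : Fin n → ℕ) → sumFin n f ≡ ℕ-Sum.sum f
sumFin≡sum zero f = refl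
sumFin≡sum (suc n) f = cong (f F.zero +_) (sumFin≡sum n (λ k → f (F.suc k)))

sumFin-cong : ∀ n {f g : Fin n → ℕ} → (∀ k → f k ≡ g k) → sumFin n f ≡ sumFin n g
sumFin-cong zero h = refl
sumFin-cong (suc n) h = cong₂ _+_ (h F.zero) (sumFin-cong n (λ k → h (F.suc k)))

sumFin-+ : ∀ n (f g : Fin n → ℕ) → sumFin n (λ k → f k + g k) ≡ sumFin n f + sumFin n g
sumFin-+ n f g = trans (sumFin≡sum n _)
  (trans (ℕ-Sum.∑-distrib-+ f g) (sym (cong₂ _+_ (sumFin≡sum n f) (sumFin≡sum n g))))

sumFin-comm : ∀ n m (f : Fin n → Fin m → ℕ) →
  sumFin n (λ i → sumFin m (f i)) ≡ sumFin m (λ j → sumFin n (λ i → f i j))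
sumFin-comm n m f = begin
  sumFin n (λ i → sumFin m (f i))          ≡⟨ sumFin-cong n (λ i → sumFin≡sum m (f i)) ⟩
  sumFin n (λ i → ℕ-Sum.sum (f i))          ≡⟨ sumFin≡sum n _ ⟩
  ℕ-Sum.sum (λ i → ℕ-Sum.sum (f i))         ≡⟨ ℕ-Sum.∑-comm f ⟩
  ℕ-Sum.sum (λ j → ℕ-Sum.sum (λ i → f i j)) ≡⟨ sym (sumFin≡sum m _) ⟩
  sumFin m (λ j → ℕ-Sum.sum (λ i → f i j))  ≡⟨ sumFin-cong m (λ j → sym (sumFin≡sum n (λ i → f i j))) ⟩
  sumFin m (λ j → sumFin n (λ i → f i j))   ∎
  where open ≡-Reasoning

sumFin-permute : ∀ n (f : Fin n → ℕ) (π : Permutation′ n) → sumFin n f ≡ sumFin n (λ k → f (π ⟨$⟩ʳ k))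
sumFin-permute n f π = trans (sumFin≡sum n f) (trans (ℕ-Sum.sum-permute f π) (sym (sumFin≡sum n _)))

-- Stated with both sides moved so that no subtraction occurs.
sumFin-exchange : ∀ n (f g : Fin n → ℕ) (p : Fin n) → (∀ k → k ≢ p → f k ≡ g k) →
  sumFin n f + g p ≡ sumFin n g + f p
sumFin-exchange (suc n) f g F.zero h
  rewrite sumFin-cong n {λ k → f (F.suc k)} {λ k → g (F.suc k)} (λ k → h (F.suc k) (λ ())) =
  rearrange (f F.zero) (g F.zero) (sumFin n (λ k → g (F.suc k)))
  where rearrange : ∀ a b c → a + c + b ≡ b + c + a
        rearrange = solve-∀
sumFin-exchange (suc n) f g (F.suc p) h rewrite h F.zero (λ ()) =
  trans (+-assoc (g F.zero) _ _)
    (trans (cong (g F.zero +_) (sumFin-exchange n (λ k → f (F.suc k)) (λ k → g (F.suc k)) p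
                                  (λ k k≢p → h (F.suc k) (k≢p ∘ FP.suc-injective))))
           (sym (+-assoc (g F.zero) _ _)))

sumFin-excess₁ : ∀ n (f g : Fin n → ℕ) (p : Fin n) e → f p ≡ e + g p →
  (∀ k → k ≢ p → f k ≡ g k) → sumFin n f ≡ e + sumFin n g
sumFin-excess₁ n f g p e fp h = +-cancelʳ-≡ (g p) _ _ (begin
  sumFin n f + g p       ≡⟨ sumFin-exchange n f g p h ⟩
  sumFin n g + f p       ≡⟨ cong (sumFin n g +_) fp ⟩
  sumFin n g + (e + g p) ≡⟨ rearrange (sumFin n g) e (g p) ⟩
  e + sumFin n g + g p   ∎)
  where
  open ≡-Reasoning
  rearrange : ∀ a b c → a + (b + c) ≡ b + a + c
  rearrange = solve-∀

sumFin-excess₂ : ∀ n (f g : Fin n → ℕ) (p q : Fin n) e → p ≢ q →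
  f p + f q ≡ e + (g p + g q) → (∀ k → k ≢ p → k ≢ q → f k ≡ g k) →
  sumFin n f ≡ e + sumFin n g
sumFin-excess₂ n f g p q e p≢q fpq h = +-cancelʳ-≡ (g p + g q) _ _ (begin
  sumFin n f + (g p + g q)       ≡⟨ sym (+-assoc (sumFin n f) _ _) ⟩
  sumFin n f + g p + g q         ≡⟨ cong (λ z → sumFin n f + z + g q) (sym (updateAt-updates p f)) ⟩
  sumFin n f + f′ p + g q        ≡⟨ cong (_+ g q) (sumFin-exchange n f f′ p f≡f′) ⟩
  sumFin n f′ + f p + g q        ≡⟨ swap₂ (sumFin n f′) (f p) (g q) ⟩
  sumFin n f′ + g q + f p        ≡⟨ cong (_+ f p) (sumFin-exchange n f′ g q f′≡g) ⟩
  sumFin n g + f′ q + f p        ≡⟨ cong (λ z → sumFin n g + z + f p) (updateAt-minimal q p f (p≢q ∘ sym)) ⟩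
  sumFin n g + f q + f p         ≡⟨ swap₃ (sumFin n g) (f q) (f p) ⟩
  sumFin n g + (f p + f q)       ≡⟨ cong (sumFin n g +_) fpq ⟩
  sumFin n g + (e + (g p + g q)) ≡⟨ rearrange (sumFin n g) e (g p + g q) ⟩
  e + sumFin n g + (g p + g q)   ∎)
  where
  open ≡-Reasoning
  f′ : Fin n → ℕ
  f′ = updateAt f p (λ _ → g p)
  f≡f′ : ∀ k → k ≢ p → f k ≡ f′ k
  f≡f′ k k≢p = sym (updateAt-minimal k p f k≢p)
  f′≡g : ∀ k → k ≢ q → f′ k ≡ g k
  f′≡g k k≢q with k F.≟ p
  ... | yes refl = updateAt-updates p f
  ... | no k≢p = trans (updateAt-minimal k p f k≢p) (h k k≢p k≢q)
  swap₂ : ∀ a b c → a + b + c ≡ a + c + b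
  swap₂ = solve-∀
  swap₃ : ∀ a b c → a + b + c ≡ a + (c + b)
  swap₃ = solve-∀
  rearrange : ∀ a b c → a + (b + c) ≡ b + a + c
  rearrange = solve-∀

-- The Rothe bumpless pipe dream

≤ᵇ≡<ᵇsuc : ∀ m n → (m ≤ᵇ n) ≡ (m <ᵇ suc n)
≤ᵇ≡<ᵇsuc zero n = refl
≤ᵇ≡<ᵇsuc (suc m) n = refl

≡ᵇ-∨-<ᵇ : ∀ m n → (n ≡ᵇ m) ∨ (m <ᵇ n) ≡ (m ≤ᵇ n)
≡ᵇ-∨-<ᵇ zero zero = refl
≡ᵇ-∨-<ᵇ zero (suc n) = refl
≡ᵇ-∨-<ᵇ (suc m) zero = refl
≡ᵇ-∨-<ᵇ (suc m) (suc n) = trans (≡ᵇ-∨-<ᵇ m n) (≤ᵇ≡<ᵇsuc m n)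

¬≡ᵇ-∧-<ᵇ : ∀ m n → not (n ≡ᵇ m) ∧ (m <ᵇ n) ≡ (m <ᵇ n)
¬≡ᵇ-∧-<ᵇ zero zero = refl
¬≡ᵇ-∧-<ᵇ zero (suc n) = refl
¬≡ᵇ-∧-<ᵇ (suc m) zero = refl
¬≡ᵇ-∧-<ᵇ (suc m) (suc n) = ¬≡ᵇ-∧-<ᵇ m n

rotheTile : (elbow east south : Bool) → Tile
rotheTile e h v = if e then relbow else if h ∧ v then cross else if h then horiz else if v then vert else empty

segE-rotheTile : ∀ e h v → segE (rotheTile e h v) ≡ e ∨ h
segE-rotheTile true h v = refl
segE-rotheTile false true true = refl
segE-rotheTile false true false = refl
segE-rotheTile false false true = refl
segE-rotheTile false false false = refl

segW-rotheTile : ∀ e h v → segW (rotheTile e h v) ≡ not e ∧ h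
segW-rotheTile true h v = refl
segW-rotheTile false true true = refl
segW-rotheTile false true false = refl
segW-rotheTile false false true = refl
segW-rotheTile false false false = refl

segS-rotheTile : ∀ e h v → segS (rotheTile e h v) ≡ e ∨ v
segS-rotheTile true h v = refl
segS-rotheTile false true true = refl
segS-rotheTile false true false = refl
segS-rotheTile false false true = refl
segS-rotheTile false false false = refl

segN-rotheTile : ∀ e h v → segN (rotheTile e h v) ≡ not e ∧ v
segN-rotheTile true h v = refl
segN-rotheTile false true true = refl
segN-rotheTile false true false = refl
segN-rotheTile false false true = refl
segN-rotheTile false false false = refl

isCross-rotheTile : ∀ e h v → isCross (rotheTile e h v) ≡ not e ∧ (h ∧ v)
isCross-rotheTile true h v = refl
isCross-rotheTile false true true = refl
isCross-rotheTile false true false = refl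
isCross-rotheTile false false true = refl
isCross-rotheTile false false false = refl

module Rothe {n : ℕ} (w : Permutation′ n) where

  -- w and w⁻¹ on ℕ-indices, with junk value 0 outside [0, n).
  W V : ℕ → ℕ
  W i = M.maybe (λ k → toℕ (w ⟨$⟩ʳ k)) 0 (idx n i)
  V j = M.maybe (λ k → toℕ (w ⟨$⟩ˡ k)) 0 (idx n j)

  W-toℕ : ∀ i → W (toℕ i) ≡ toℕ (w ⟨$⟩ʳ i)
  W-toℕ i rewrite idx-toℕ n i = refl

  V-toℕ : ∀ j → V (toℕ j) ≡ toℕ (w ⟨$⟩ˡ j)
  V-toℕ j rewrite idx-toℕ n j = refl

  W<n : ∀ {i} → i < n → W i < n
  W<n i<n = subst (λ k → W k < n) (FP.toℕ-fromℕ< i<n)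
    (subst (_< n) (sym (W-toℕ (fromℕ< i<n))) (FP.toℕ<n _))

  V<n : ∀ {j} → j < n → V j < n
  V<n j<n = subst (λ k → V k < n) (FP.toℕ-fromℕ< j<n)
    (subst (_< n) (sym (V-toℕ (fromℕ< j<n))) (FP.toℕ<n _))

  V∘W : ∀ {i} → i < n → V (W i) ≡ i
  V∘W i<n = subst (λ k → V (W k) ≡ k) (FP.toℕ-fromℕ< i<n)
    (trans (cong V (W-toℕ (fromℕ< i<n))) (trans (V-toℕ _) (cong toℕ (inverseˡ w))))

  W∘V : ∀ {j} → j < n → W (V j) ≡ j
  W∘V j<n = subst (λ k → W (V k) ≡ k) (FP.toℕ-fromℕ< j<n)
    (trans (cong W (V-toℕ (fromℕ< j<n))) (trans (W-toℕ _) (cong toℕ (inverseʳ w))))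

  W-injective : ∀ {i k} → i < n → k < n → W i ≡ W k → i ≡ k
  W-injective i<n k<n e = trans (sym (V∘W i<n)) (trans (cong V e) (V∘W k<n))

  rotheH rotheV : ℕ → ℕ → Bool
  rotheH i j = W i ≤ᵇ j
  rotheV i j = V j ≤ᵇ i

  isElbow rowPipe columnPipe : Fin n → Fin n → Bool
  isElbow i j = toℕ j ≡ᵇ W (toℕ i)
  rowPipe i j = W (toℕ i) <ᵇ toℕ j
  columnPipe i j = V (toℕ j) <ᵇ toℕ i

  rothe-rotheTile : ∀ i j → rothe w i j ≡ rotheTile (isElbow i j) (rowPipe i j) (columnPipe i j)
  rothe-rotheTile i j rewrite W-toℕ i | V-toℕ j = refl

  isElbow-column : ∀ i j → isElbow i j ≡ (toℕ i ≡ᵇ V (toℕ j))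
  isElbow-column i j rewrite W-toℕ i | V-toℕ j =
    does-⇔ (mk⇔ to from) (toℕ j ≟ toℕ (w ⟨$⟩ʳ i)) (toℕ i ≟ toℕ (w ⟨$⟩ˡ j))
    where
    to : toℕ j ≡ toℕ (w ⟨$⟩ʳ i) → toℕ i ≡ toℕ (w ⟨$⟩ˡ j)
    to e = cong toℕ (trans (sym (inverseˡ w)) (cong (w ⟨$⟩ˡ_) (sym (FP.toℕ-injective e))))
    from : toℕ i ≡ toℕ (w ⟨$⟩ˡ j) → toℕ j ≡ toℕ (w ⟨$⟩ʳ i)
    from e = cong toℕ (trans (sym (inverseʳ w)) (cong (w ⟨$⟩ʳ_) (sym (FP.toℕ-injective e))))

  rothe-segE : ∀ i j → segE (rothe w i j) ≡ rotheH (toℕ i) (toℕ j)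
  rothe-segE i j = begin
    segE (rothe w i j)                                 ≡⟨ cong segE (rothe-rotheTile i j) ⟩
    segE (rotheTile (isElbow i j) (rowPipe i j) (columnPipe i j))
                                                       ≡⟨ segE-rotheTile (isElbow i j) (rowPipe i j) (columnPipe i j) ⟩
    isElbow i j ∨ rowPipe i j                          ≡⟨ ≡ᵇ-∨-<ᵇ (W (toℕ i)) (toℕ j) ⟩
    rotheH (toℕ i) (toℕ j)                             ∎
    where open ≡-Reasoning

  rothe-segW : ∀ i j → segW (rothe w i j) ≡ fromLeft rotheH (toℕ i) (toℕ j)
  rothe-segW i j = begin
    segW (rothe w i j)                                 ≡⟨ cong segW (rothe-rotheTile i j) ⟩
    segW (rotheTile (isElbow i j) (rowPipe i j) (columnPipe i j))
                                                       ≡⟨ segW-rotheTile (isElbow i j) (rowPipe i j) (columnPipe i j) ⟩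
    not (isElbow i j) ∧ rowPipe i j                    ≡⟨ ¬≡ᵇ-∧-<ᵇ (W (toℕ i)) (toℕ j) ⟩
    rowPipe i j                                        ≡⟨ left (toℕ j) ⟩
    fromLeft rotheH (toℕ i) (toℕ j)                    ∎
    where
    open ≡-Reasoning
    left : ∀ k → (W (toℕ i) <ᵇ k) ≡ fromLeft rotheH (toℕ i) k
    left zero = refl
    left (suc k) = sym (≤ᵇ≡<ᵇsuc (W (toℕ i)) k)

  rothe-segS : ∀ i j → segS (rothe w i j) ≡ rotheV (toℕ i) (toℕ j)
  rothe-segS i j = begin
    segS (rothe w i j)                                 ≡⟨ cong segS (rothe-rotheTile i j) ⟩
    segS (rotheTile (isElbow i j) (rowPipe i j) (columnPipe i j))
                                                       ≡⟨ segS-rotheTile (isElbow i j) (rowPipe i j) (columnPipe i j) ⟩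
    isElbow i j ∨ columnPipe i j                       ≡⟨ cong (_∨ columnPipe i j) (isElbow-column i j) ⟩
    (toℕ i ≡ᵇ V (toℕ j)) ∨ columnPipe i j              ≡⟨ ≡ᵇ-∨-<ᵇ (V (toℕ j)) (toℕ i) ⟩
    rotheV (toℕ i) (toℕ j)                             ∎
    where open ≡-Reasoning

  rothe-segN : ∀ i j → segN (rothe w i j) ≡ fromAbove rotheV (toℕ i) (toℕ j)
  rothe-segN i j = begin
    segN (rothe w i j)                                 ≡⟨ cong segN (rothe-rotheTile i j) ⟩
    segN (rotheTile (isElbow i j) (rowPipe i j) (columnPipe i j))
                                                       ≡⟨ segN-rotheTile (isElbow i j) (rowPipe i j) (columnPipe i j) ⟩
    not (isElbow i j) ∧ columnPipe i j                 ≡⟨ cong (λ b → not b ∧ columnPipe i j) (isElbow-column i j) ⟩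
    not (toℕ i ≡ᵇ V (toℕ j)) ∧ columnPipe i j          ≡⟨ ¬≡ᵇ-∧-<ᵇ (V (toℕ j)) (toℕ i) ⟩
    columnPipe i j                                     ≡⟨ above (toℕ i) ⟩
    fromAbove rotheV (toℕ i) (toℕ j)                   ∎
    where
    open ≡-Reasoning
    above : ∀ k → (V (toℕ j) <ᵇ k) ≡ fromAbove rotheV k (toℕ j)
    above zero = refl
    above (suc k) = sym (≤ᵇ≡<ᵇsuc (V (toℕ j)) k)

  rothe-segments : Segments (rothe w) rotheH rotheV
  rothe-segments = record
    { east  = tileAt-∀ (rothe w) (λ i j t → segE t ≡ rotheH i j) rothe-segE
    ; south = tileAt-∀ (rothe w) (λ i j t → segS t ≡ rotheV i j) rothe-segS
    ; north = tileAt-∀ (rothe w) (λ i j t → segN t ≡ fromAbove rotheV i j) rothe-segN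
    ; west  = tileAt-∀ (rothe w) (λ i j t → segW t ≡ fromLeft rotheH i j) rothe-segW }

  rothe-isCross : ∀ i j → isCross (rothe w i j) ≡ (W (toℕ i) <ᵇ toℕ j) ∧ (V (toℕ j) <ᵇ toℕ i)
  rothe-isCross i j = begin
    isCross (rothe w i j)                                   ≡⟨ cong isCross (rothe-rotheTile i j) ⟩
    isCross (rotheTile (isElbow i j) (rowPipe i j) (columnPipe i j))
                                                            ≡⟨ isCross-rotheTile (isElbow i j) (rowPipe i j) (columnPipe i j) ⟩
    not (isElbow i j) ∧ (rowPipe i j ∧ columnPipe i j)      ≡⟨ sym (∧-assoc (not (isElbow i j)) _ _) ⟩
    (not (isElbow i j) ∧ rowPipe i j) ∧ columnPipe i j      ≡⟨ cong (_∧ columnPipe i j) (¬≡ᵇ-∧-<ᵇ (W (toℕ i)) (toℕ j)) ⟩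
    rowPipe i j ∧ columnPipe i j                            ∎
    where open ≡-Reasoning

  rothe-no-cross-row : ∀ i j → ¬ W (toℕ i) < toℕ j → isCross (rothe w i j) ≡ false
  rothe-no-cross-row i j ¬lt = trans (rothe-isCross i j) (cong (_∧ columnPipe i j) (≮⇒<ᵇ≡false ¬lt))

  rothe-no-cross-column : ∀ i j → ¬ V (toℕ j) < toℕ i → isCross (rothe w i j) ≡ false
  rothe-no-cross-column i j ¬lt =
    trans (rothe-isCross i j) (trans (cong (rowPipe i j ∧_) (≮⇒<ᵇ≡false ¬lt)) (∧-zeroʳ (rowPipe i j)))

  numCross-rothe : numCross (rothe w) ≡ inv w
  numCross-rothe = sym (begin
    inv w
      ≡⟨ sumFin-comm n n _ ⟩
    sumFin n (λ j → sumFin n (λ i → b2n ((toℕ i <ᵇ toℕ j) ∧ (toℕ (w ⟨$⟩ʳ j) <ᵇ toℕ (w ⟨$⟩ʳ i)))))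
      ≡⟨ sumFin-cong n (λ j → sumFin-permute n _ (flip w)) ⟩
    sumFin n (λ j → sumFin n (λ c →
      b2n ((toℕ (w ⟨$⟩ˡ c) <ᵇ toℕ j) ∧ (toℕ (w ⟨$⟩ʳ j) <ᵇ toℕ (w ⟨$⟩ʳ (w ⟨$⟩ˡ c))))))
      ≡⟨ sumFin-cong n (λ j → sumFin-cong n (λ c → cong b2n (cross-at j c))) ⟩
    numCross (rothe w) ∎)
    where
    open ≡-Reasoning
    cross-at : ∀ j c → (toℕ (w ⟨$⟩ˡ c) <ᵇ toℕ j) ∧ (toℕ (w ⟨$⟩ʳ j) <ᵇ toℕ (w ⟨$⟩ʳ (w ⟨$⟩ˡ c)))
                       ≡ isCross (rothe w j c)
    cross-at j c rewrite inverseʳ w {c} | rothe-isCross j c | W-toℕ j | V-toℕ c =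
      ∧-comm (toℕ (w ⟨$⟩ˡ c) <ᵇ toℕ j) _

-- Where to flip

least-below : (P : ℕ → Set) → (∀ k → Dec (P k)) → ∀ m →
  (∃[ k ] k < m × P k × (∀ k′ → k′ < k → ¬ P k′)) ⊎ (∀ k → k < m → ¬ P k)
least-below P P? zero = inj₂ (λ k ())
least-below P P? (suc m) with least-below P P? m
... | inj₁ (k , k<m , Pk , least) = inj₁ (k , m≤n⇒m≤1+n k<m , Pk , least)
... | inj₂ none with P? m
...   | yes Pm = inj₁ (m , ≤-refl , Pm , none)
...   | no ¬Pm = inj₂ (λ k k<1+m → [ none k , (λ { refl → ¬Pm }) ]′ (m≤n⇒m<n∨m≡n (≤-pred k<1+m)))

-- The block of the flip: rows i₀, i₀ + 1 and columns j₀, j₀ + 1.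
record FlipSite {n : ℕ} (w : Permutation′ n) : Set where
  open Rothe w
  field
    i₀ j₀ : ℕ
    1+i₀<n : suc i₀ < n
    1+j₀<n : suc j₀ < n
    W[1+i₀]≤j₀ : W (suc i₀) ≤ j₀
    V[1+j₀]≤i₀ : V (suc j₀) ≤ i₀
    i₀<V[j₀] : i₀ < V j₀
    1+j₀≤W[i₀] : suc j₀ ≤ W i₀
    between : ∀ k → V (suc j₀) < k → k < suc i₀ → W k < W (suc i₀) ⊎ suc j₀ < W k

module _ {n : ℕ} (w : Permutation′ n) where
  open Rothe w

  Descent : ℕ → Set
  Descent i = suc i < n × W (suc i) < W i

  no-descent⇒identity : (∀ i → i < n → ¬ Descent i) → ∀ i → w ⟨$⟩ʳ i ≡ i
  no-descent⇒identity none i = FP.toℕ-injective (trans (sym (W-toℕ i)) (W≡id (FP.toℕ<n i)))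
    where
    increasing : ∀ i → suc i < n → W i < W (suc i)
    increasing i 1+i<n with <-cmp (W i) (W (suc i))
    ... | tri< lt _ _ = lt
    ... | tri≈ _ eq _ = contradiction (W-injective (<-trans (n<1+n i) 1+i<n) 1+i<n eq) (<⇒≢ (n<1+n i))
    ... | tri> _ _ gt = contradiction (1+i<n , gt) (none i (<-trans (n<1+n i) 1+i<n))
    ≤W : ∀ i → i < n → i ≤ W i
    ≤W zero _ = z≤n
    ≤W (suc i) 1+i<n = ≤-trans (s≤s (≤W i (<-trans (n<1+n i) 1+i<n))) (increasing i 1+i<n)
    room : ∀ d i → i + d < n → W i + d < n
    room zero i i<n rewrite +-identityʳ i | +-identityʳ (W i) = W<n i<n
    room (suc d) i i+d<n rewrite +-suc (W i) d =
      ≤-<-trans (+-monoˡ-≤ d (increasing i 1+i<n)) (room d (suc i) (subst (_< n) (+-suc i d) i+d<n))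
      where 1+i<n : suc i < n
            1+i<n = ≤-<-trans (s≤s (m≤m+n i d)) (subst (_< n) (+-suc i d) i+d<n)
    -- i ≤ W i, and the n ∸ 1 ∸ i larger positions need values above W i.
    W≡id : ∀ {i} → i < n → W i ≡ i
    W≡id {i} i<n = ≤-antisym (≤-pred W[i]<1+i) (≤W i i<n)
      where
      d = n ∸ suc i
      i+d+1≡n : suc i + d ≡ n
      i+d+1≡n = m+[n∸m]≡n i<n
      W[i]<1+i : W i < suc i
      W[i]<1+i = +-cancelʳ-< d (W i) (suc i)
        (subst (W i + d <_) (sym i+d+1≡n) (room d i (subst (i + d <_) i+d+1≡n (n<1+n (i + d)))))

  flipSite : ¬ (∀ i → w ⟨$⟩ʳ i ≡ i) → FlipSite w
  flipSite ¬id with least-below Descent (λ k → (suc k <? n) ×-dec (W (suc k) <? W k)) n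
  ... | inj₂ none = contradiction (no-descent⇒identity none) ¬id
  ... | inj₁ (i₀ , _ , (1+i₀<n , descent) , _) = site
    where
    i₀<n : i₀ < n
    i₀<n = <-trans (n<1+n i₀) 1+i₀<n
    Target : ℕ → Set
    Target v = W (suc i₀) < v × V v ≤ i₀
    target-W[i₀] : Target (W i₀)
    target-W[i₀] = descent , ≤-reflexive (V∘W i₀<n)
    site : FlipSite w
    site with least-below Target (λ v → (W (suc i₀) <? v) ×-dec (V v ≤? i₀)) n
    ... | inj₂ none = contradiction target-W[i₀] (none (W i₀) (W<n i₀<n))
    ... | inj₁ (zero , _ , (() , _) , _)
    ... | inj₁ (suc j₀ , 1+j₀<n , (lt , V[1+j₀]≤i₀) , least) = record
      { i₀ = i₀ ; j₀ = j₀ ; 1+i₀<n = 1+i₀<n ; 1+j₀<n = 1+j₀<n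
      ; W[1+i₀]≤j₀ = ≤-pred lt ; V[1+j₀]≤i₀ = V[1+j₀]≤i₀
      ; i₀<V[j₀] = i₀<V[j₀] ; 1+j₀≤W[i₀] = 1+j₀≤W[i₀] ; between = between }
      where
      1+j₀≤W[i₀] : suc j₀ ≤ W i₀
      1+j₀≤W[i₀] with suc j₀ ≤? W i₀
      ... | yes le = le
      ... | no ¬le = contradiction target-W[i₀] (least (W i₀) (≰⇒> ¬le))
      i₀<V[j₀] : i₀ < V j₀
      i₀<V[j₀] with m≤n⇒m<n∨m≡n (≤-pred lt)
      ... | inj₂ e = subst (i₀ <_) (sym (trans (cong V (sym e)) (V∘W 1+i₀<n))) ≤-refl
      ... | inj₁ l with i₀ <? V j₀
      ...   | yes p = p
      ...   | no ¬p = contradiction (l , ≮⇒≥ ¬p) (least j₀ ≤-refl)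
      between : ∀ k → V (suc j₀) < k → k < suc i₀ → W k < W (suc i₀) ⊎ suc j₀ < W k
      between k r<k k<1+i₀ with <-cmp (W k) (W (suc i₀))
      ... | tri< lt _ _ = inj₁ lt
      ... | tri≈ _ eq _ = contradiction (W-injective k<n 1+i₀<n eq) (<⇒≢ k<1+i₀)
        where k<n = <-trans k<1+i₀ 1+i₀<n
      ... | tri> _ _ gt with <-cmp (W k) (suc j₀)
      ...   | tri> _ _ gt′ = inj₂ gt′
      ...   | tri≈ _ eq _ = contradiction (trans (sym (V∘W (<-trans k<1+i₀ 1+i₀<n))) (cong V eq)) (>⇒≢ r<k)
      ...   | tri< lt _ _ =
        contradiction (gt , subst (_≤ i₀) (sym (V∘W (<-trans k<1+i₀ 1+i₀<n))) (≤-pred k<1+i₀)) (least (W k) lt)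

-- Inversions

isInversion : (a b ua ub : ℕ) → ℕ
isInversion a b ua ub = b2n ((a <ᵇ b) ∧ (ub <ᵇ ua))

inversions : ∀ n → (Fin n → ℕ) → ℕ
inversions n u = sumFin n λ a → sumFin n λ b → isInversion (toℕ a) (toℕ b) (u a) (u b)

exchange-inversions-ending : ∀ A P Q ua up uq → P < Q → uq < up → A ≢ P → A ≢ Q →
  (P < A → A < Q → ua < uq ⊎ up < ua) →
  isInversion A P ua up + isInversion A Q ua uq ≡ isInversion A P ua uq + isInversion A Q ua up
exchange-inversions-ending A P Q ua up uq P<Q uq<up A≢P A≢Q gap with <-cmp A P
... | tri≈ _ A≡P _ = contradiction A≡P A≢P
... | tri< A<P _ _ rewrite <⇒<ᵇ≡true A<P | <⇒<ᵇ≡true (<-trans A<P P<Q) =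
  +-comm (b2n (up <ᵇ ua)) (b2n (uq <ᵇ ua))
... | tri> _ _ A>P rewrite ≮⇒<ᵇ≡false (<⇒≯ A>P) with <-cmp A Q
...   | tri≈ _ A≡Q _ = contradiction A≡Q A≢Q
...   | tri> _ _ A>Q rewrite ≮⇒<ᵇ≡false (<⇒≯ A>Q) = refl
...   | tri< A<Q _ _ rewrite <⇒<ᵇ≡true A<Q with gap A>P A<Q
...     | inj₁ ua<uq rewrite ≮⇒<ᵇ≡false (<⇒≯ ua<uq) | ≮⇒<ᵇ≡false (<⇒≯ (<-trans ua<uq uq<up)) = refl
...     | inj₂ up<ua rewrite <⇒<ᵇ≡true up<ua | <⇒<ᵇ≡true (<-trans uq<up up<ua) = refl

exchange-inversions-starting : ∀ B P Q ub up uq → P < Q → uq < up → B ≢ P → B ≢ Q →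
  (P < B → B < Q → ub < uq ⊎ up < ub) →
  isInversion P B up ub + isInversion Q B uq ub ≡ isInversion P B uq ub + isInversion Q B up ub
exchange-inversions-starting B P Q ub up uq P<Q uq<up B≢P B≢Q gap with <-cmp B P
... | tri≈ _ B≡P _ = contradiction B≡P B≢P
... | tri< B<P _ _ rewrite ≮⇒<ᵇ≡false (<⇒≯ B<P) | ≮⇒<ᵇ≡false (<⇒≯ (<-trans B<P P<Q)) = refl
... | tri> _ _ B>P rewrite <⇒<ᵇ≡true B>P with <-cmp B Q
...   | tri≈ _ B≡Q _ = contradiction B≡Q B≢Q
...   | tri> _ _ B>Q rewrite <⇒<ᵇ≡true B>Q = +-comm (b2n (ub <ᵇ up)) (b2n (ub <ᵇ uq))
...   | tri< B<Q _ _ rewrite ≮⇒<ᵇ≡false (<⇒≯ B<Q) with gap B>P B<Q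
...     | inj₁ ub<uq rewrite <⇒<ᵇ≡true ub<uq | <⇒<ᵇ≡true (<-trans ub<uq uq<up) = refl
...     | inj₂ up<ub rewrite ≮⇒<ᵇ≡false (<⇒≯ (<-trans uq<up up<ub)) | ≮⇒<ᵇ≡false (<⇒≯ up<ub) = refl

inversions-exchange : ∀ n (u u′ : Fin n → ℕ) (p q : Fin n) → toℕ p < toℕ q → u q < u p →
  u′ p ≡ u q → u′ q ≡ u p → (∀ k → k ≢ p → k ≢ q → u′ k ≡ u k) →
  (∀ k → toℕ p < toℕ k → toℕ k < toℕ q → u k < u q ⊎ u p < u k) →
  inversions n u ≡ 1 + inversions n u′
inversions-exchange n u u′ p q p<q uq<up u′p u′q u′k gap =
  sumFin-excess₂ n (row u) (row u′) p q 1 p≢q rows-p-q rows-other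
  where
  P Q : ℕ
  P = toℕ p
  Q = toℕ q
  p≢q : p ≢ q
  p≢q = <⇒≢ p<q ∘ cong toℕ
  toℕ-≢ : ∀ {k k′ : Fin n} → k ≢ k′ → toℕ k ≢ toℕ k′
  toℕ-≢ k≢k′ = k≢k′ ∘ FP.toℕ-injective
  row : (Fin n → ℕ) → Fin n → ℕ
  row v a = sumFin n (λ b → isInversion (toℕ a) (toℕ b) (v a) (v b))
  rows-other : ∀ a → a ≢ p → a ≢ q → row u a ≡ row u′ a
  rows-other a a≢p a≢q = sumFin-excess₂ n _ _ p q 0 p≢q at-p-q elsewhere
    where
    at-p-q : isInversion (toℕ a) P (u a) (u p) + isInversion (toℕ a) Q (u a) (u q) ≡
             0 + (isInversion (toℕ a) P (u′ a) (u′ p) + isInversion (toℕ a) Q (u′ a) (u′ q))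
    at-p-q rewrite u′p | u′q | u′k a a≢p a≢q =
      exchange-inversions-ending (toℕ a) P Q (u a) (u p) (u q) p<q uq<up (toℕ-≢ a≢p) (toℕ-≢ a≢q) (gap a)
    elsewhere : ∀ b → b ≢ p → b ≢ q →
      isInversion (toℕ a) (toℕ b) (u a) (u b) ≡ isInversion (toℕ a) (toℕ b) (u′ a) (u′ b)
    elsewhere b b≢p b≢q rewrite u′k a a≢p a≢q | u′k b b≢p b≢q = refl
  pair : (Fin n → ℕ) → Fin n → ℕ
  pair v b = isInversion P (toℕ b) (v p) (v b) + isInversion Q (toℕ b) (v q) (v b)
  pairs : sumFin n (pair u) ≡ 1 + sumFin n (pair u′)
  pairs = sumFin-excess₁ n (pair u) (pair u′) q 1 at-q elsewhere
    where
    at-q : pair u q ≡ 1 + pair u′ q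
    at-q rewrite <⇒<ᵇ≡true p<q | ≮⇒<ᵇ≡false (<-irrefl {Q} refl) | <⇒<ᵇ≡true uq<up
               | u′p | u′q | ≮⇒<ᵇ≡false (<⇒≯ uq<up) = refl
    elsewhere : ∀ b → b ≢ q → pair u b ≡ pair u′ b
    elsewhere b b≢q with b F.≟ p
    ... | yes refl rewrite ≮⇒<ᵇ≡false (<-irrefl {P} refl) | ≮⇒<ᵇ≡false (<⇒≯ p<q) = refl
    ... | no b≢p rewrite u′k b b≢p b≢q | u′p | u′q =
      exchange-inversions-starting (toℕ b) P Q (u b) (u p) (u q) p<q uq<up (toℕ-≢ b≢p) (toℕ-≢ b≢q) (gap b)
  rows-p-q : row u p + row u q ≡ 1 + (row u′ p + row u′ q)
  rows-p-q = trans (sym (sumFin-+ n _ _)) (trans pairs (cong suc (sumFin-+ n _ _)))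

-- The flip

isCell : (i j x y : ℕ) → Bool
isCell i j x y = (i ≡ᵇ x) ∧ (j ≡ᵇ y)

isCell-≡ : ∀ x y → isCell x y x y ≡ true
isCell-≡ x y = dec-true ((x ≟ x) ×-dec (y ≟ y)) (refl , refl)

isCell-≢ : ∀ {i j x y} → ¬ (i ≡ x × j ≡ y) → isCell i j x y ≡ false
isCell-≢ {i} {j} {x} {y} = dec-false ((i ≟ x) ×-dec (j ≟ y))

module Flip {n : ℕ} (w : Permutation′ n) (site : FlipSite w) where
  open Rothe w
  open FlipSite site

  i₁ j₁ r : ℕ
  i₁ = suc i₀
  j₁ = suc j₀
  r = V j₁

  i₀<n : i₀ < n
  i₀<n = <-trans (n<1+n i₀) 1+i₀<n
  j₀<n : j₀ < n
  j₀<n = <-trans (n<1+n j₀) 1+j₀<n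
  r<n : r < n
  r<n = ≤-<-trans V[1+j₀]≤i₀ i₀<n
  r<i₁ : r < i₁
  r<i₁ = s≤s V[1+j₀]≤i₀
  i₁≢i₀ : i₁ ≢ i₀
  i₁≢i₀ = >⇒≢ (n<1+n i₀)
  j₁≢j₀ : j₁ ≢ j₀
  j₁≢j₀ = >⇒≢ (n<1+n j₀)
  W[r]≡j₁ : W r ≡ j₁
  W[r]≡j₁ = W∘V 1+j₀<n
  V[W[i₁]]≡i₁ : V (W i₁) ≡ i₁
  V[W[i₁]]≡i₁ = V∘W 1+i₀<n
  W[i₀]≡j₁⇒r≡i₀ : W i₀ ≡ j₁ → r ≡ i₀
  W[i₀]≡j₁⇒r≡i₀ e = trans (cong V (sym e)) (V∘W i₀<n)

  -- The flip adds the segments on the east and south edges of the top left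
  -- cell (i₀, j₀) and removes those on the east edge of the bottom left cell
  -- and on the south edge of the top right cell.
  H′ V′ : ℕ → ℕ → Bool
  H′ i j = if isCell i j i₀ j₀ then true else if isCell i j i₁ j₀ then false else rotheH i j
  V′ i j = if isCell i j i₀ j₀ then true else if isCell i j i₀ j₁ then false else rotheV i j

  H′-topLeft : H′ i₀ j₀ ≡ true
  H′-topLeft rewrite isCell-≡ i₀ j₀ = refl
  H′-bottomLeft : H′ i₁ j₀ ≡ false
  H′-bottomLeft rewrite isCell-≢ {i₁} {j₀} {i₀} {j₀} (i₁≢i₀ ∘ proj₁) | isCell-≡ i₁ j₀ = refl
  H′-elsewhere : ∀ {i j} → ¬ (i ≡ i₀ × j ≡ j₀) → ¬ (i ≡ i₁ × j ≡ j₀) → H′ i j ≡ rotheH i j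
  H′-elsewhere ¬tl ¬bl rewrite isCell-≢ ¬tl | isCell-≢ ¬bl = refl

  V′-topLeft : V′ i₀ j₀ ≡ true
  V′-topLeft rewrite isCell-≡ i₀ j₀ = refl
  V′-topRight : V′ i₀ j₁ ≡ false
  V′-topRight rewrite isCell-≢ {i₀} {j₁} {i₀} {j₀} (j₁≢j₀ ∘ proj₂) | isCell-≡ i₀ j₁ = refl
  V′-elsewhere : ∀ {i j} → ¬ (i ≡ i₀ × j ≡ j₀) → ¬ (i ≡ i₀ × j ≡ j₁) → V′ i j ≡ rotheV i j
  V′-elsewhere ¬tl ¬tr rewrite isCell-≢ ¬tl | isCell-≢ ¬tr = refl

  H′-true : ∀ {i t} → (i ≡ i₁ → t ≢ j₀) → W i ≤ t → H′ i t ≡ true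
  H′-true {i} {t} ¬bl le with i ≟ i₀ | t ≟ j₀
  ... | yes refl | yes refl = H′-topLeft
  ... | yes _ | no t≢j₀ = trans (H′-elsewhere (t≢j₀ ∘ proj₂) (t≢j₀ ∘ proj₂)) (dec-true (W i ≤? t) le)
  ... | no i≢i₀ | _ = trans (H′-elsewhere (i≢i₀ ∘ proj₁) (λ (a , b) → ¬bl a b)) (dec-true (W i ≤? t) le)

  H′-false : ∀ {i t} → (i ≡ i₀ → t ≢ j₀) → t < W i → H′ i t ≡ false
  H′-false {i} {t} ¬tl lt with i ≟ i₁ | t ≟ j₀
  ... | yes refl | yes refl = H′-bottomLeft
  ... | yes _ | no t≢j₀ = trans (H′-elsewhere (t≢j₀ ∘ proj₂) (t≢j₀ ∘ proj₂)) (dec-false (W i ≤? t) (<⇒≱ lt))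
  ... | no i≢i₁ | _ = trans (H′-elsewhere (λ (a , b) → ¬tl a b) (i≢i₁ ∘ proj₁)) (dec-false (W i ≤? t) (<⇒≱ lt))

  V′-true : ∀ {t c} → (c ≡ j₁ → t ≢ i₀) → V c ≤ t → V′ t c ≡ true
  V′-true {t} {c} ¬tr le with t ≟ i₀ | c ≟ j₀
  ... | yes refl | yes refl = V′-topLeft
  ... | yes _ | no c≢j₀ = trans (V′-elsewhere (c≢j₀ ∘ proj₂) (λ (a , b) → ¬tr b a)) (dec-true (V c ≤? t) le)
  ... | no t≢i₀ | _ = trans (V′-elsewhere (t≢i₀ ∘ proj₁) (t≢i₀ ∘ proj₁)) (dec-true (V c ≤? t) le)

  V′-false : ∀ {t c} → (t ≡ i₀ → c ≢ j₀) → t < V c → V′ t c ≡ false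
  V′-false {t} {c} ¬tl lt with t ≟ i₀ | c ≟ j₁
  ... | yes refl | yes refl = V′-topRight
  ... | yes _ | no c≢j₁ = trans (V′-elsewhere (λ (a , b) → ¬tl a b) (c≢j₁ ∘ proj₂)) (dec-false (V c ≤? t) (<⇒≱ lt))
  ... | no t≢i₀ | _ = trans (V′-elsewhere (t≢i₀ ∘ proj₁) (t≢i₀ ∘ proj₁)) (dec-false (V c ≤? t) (<⇒≱ lt))

  fromAbove-V′-false : ∀ i c → (i ≡ i₁ → c ≢ j₀) → i ≤ V c → fromAbove V′ i c ≡ false
  fromAbove-V′-false zero c _ _ = refl
  fromAbove-V′-false (suc t) c ¬bl le = V′-false (¬bl ∘ cong suc) le

  fromLeft-H′-false : ∀ i c → (i ≡ i₀ → c ≢ j₁) → c ≤ W i → fromLeft H′ i c ≡ false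
  fromLeft-H′-false i zero _ _ = refl
  fromLeft-H′-false i (suc t) ¬tr le = H′-false (λ e → ¬tr e ∘ cong suc) le

  -- The top right cell is the elbow of row i₀ iff r = i₀, the bottom left
  -- one that of row i₁ iff w i₁ = j₀.
  topRight bottomLeft : Tile
  topRight = if W i₀ ≡ᵇ j₁ then horiz else jelbow
  bottomLeft = if W i₁ ≡ᵇ j₀ then vert else jelbow

  flipTile : ℕ → ℕ → Tile → Tile
  flipTile i j t =
    if isCell i j i₀ j₀ then relbow else if isCell i j i₀ j₁ then topRight else
    if isCell i j i₁ j₀ then bottomLeft else if isCell i j i₁ j₁ then relbow else t

  D′ : Grid n
  D′ i j = flipTile (toℕ i) (toℕ j) (rothe w i j)

  Outside : ℕ → ℕ → Set
  Outside i j = ¬ InBlock j₁ i₁ i j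

  data Position (i j : ℕ) : Set where
    at-topLeft     : i ≡ i₀ → j ≡ j₀ → Position i j
    at-topRight    : i ≡ i₀ → j ≡ j₁ → Position i j
    at-bottomLeft  : i ≡ i₁ → j ≡ j₀ → Position i j
    at-bottomRight : i ≡ i₁ → j ≡ j₁ → Position i j
    outside        : Outside i j → Position i j

  position : ∀ i j → Position i j
  position i j with i ≟ i₀ | i ≟ i₁ | j ≟ j₀ | j ≟ j₁
  ... | yes a | _ | yes b | _ = at-topLeft a b
  ... | yes a | _ | no _ | yes b = at-topRight a b
  ... | no _ | yes a | yes b | _ = at-bottomLeft a b
  ... | no _ | yes a | no _ | yes b = at-bottomRight a b
  ... | _ | _ | no b | no b′ = outside λ (_ , c) → [ b ∘ suc-injective , b′ ]′ c
  ... | no a | no a′ | _ | _ = outside λ (c , _) → [ a ∘ suc-injective , a′ ]′ c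

  flipTile-topLeft : ∀ t → flipTile i₀ j₀ t ≡ relbow
  flipTile-topLeft t rewrite isCell-≡ i₀ j₀ = refl

  flipTile-topRight : ∀ t → flipTile i₀ j₁ t ≡ topRight
  flipTile-topRight t rewrite isCell-≢ {i₀} {j₁} {i₀} {j₀} (j₁≢j₀ ∘ proj₂) | isCell-≡ i₀ j₁ = refl

  flipTile-bottomLeft : ∀ t → flipTile i₁ j₀ t ≡ bottomLeft
  flipTile-bottomLeft t
    rewrite isCell-≢ {i₁} {j₀} {i₀} {j₀} (i₁≢i₀ ∘ proj₁) | isCell-≢ {i₁} {j₀} {i₀} {j₁} (i₁≢i₀ ∘ proj₁)
          | isCell-≡ i₁ j₀ = refl

  flipTile-bottomRight : ∀ t → flipTile i₁ j₁ t ≡ relbow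
  flipTile-bottomRight t
    rewrite isCell-≢ {i₁} {j₁} {i₀} {j₀} (i₁≢i₀ ∘ proj₁) | isCell-≢ {i₁} {j₁} {i₀} {j₁} (i₁≢i₀ ∘ proj₁)
          | isCell-≢ {i₁} {j₁} {i₁} {j₀} (j₁≢j₀ ∘ proj₂) | isCell-≡ i₁ j₁ = refl

  flipTile-outside : ∀ {i j} t → Outside i j → flipTile i j t ≡ t
  flipTile-outside t out
    rewrite isCell-≢ (λ (a , b) → out (inj₁ (cong suc a) , inj₁ (cong suc b)))
          | isCell-≢ (λ (a , b) → out (inj₁ (cong suc a) , inj₂ b))
          | isCell-≢ (λ (a , b) → out (inj₂ a , inj₁ (cong suc b)))
          | isCell-≢ (λ (a , b) → out (inj₂ a , inj₂ b)) = refl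

  tileAt-D′ : ∀ i j → i < n → j < n → tileAt D′ i j ≡ flipTile i j (tileAt (rothe w) i j)
  tileAt-D′ = tileAt-∀ D′ (λ i j t → t ≡ flipTile i j (tileAt (rothe w) i j))
    (λ i j → cong (flipTile (toℕ i) (toℕ j)) (sym (tileAt-toℕ (rothe w) i j)))

  module RotheSegments = Segments rothe-segments

  W[i₁]<j₀ : W i₁ ≢ j₀ → W i₁ < j₀
  W[i₁]<j₀ ne = ≤∧≢⇒< W[1+i₀]≤j₀ ne

  r<i₀ : W i₀ ≢ j₁ → r < i₀
  r<i₀ ne = ≤∧≢⇒< V[1+j₀]≤i₀ (λ e → ne (trans (cong W (sym e)) W[r]≡j₁))

  ¬above-topLeft : fromAbove V′ i₀ j₀ ≡ false
  ¬above-topLeft = fromAbove-V′-false i₀ j₀ (λ e → contradiction (sym e) i₁≢i₀) (<⇒≤ i₀<V[j₀])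

  fromLeft-H′-row-i₁ : ∀ t → W i₁ < t → t ≤ j₀ → fromLeft H′ i₁ t ≡ true
  fromLeft-H′-row-i₁ (suc t) (s≤s W[i₁]≤t) t<j₀ = H′-true (λ _ → <⇒≢ t<j₀) W[i₁]≤t

  segE-flip : ∀ i j → i < n → j < n → segE (flipTile i j (tileAt (rothe w) i j)) ≡ H′ i j
  segE-flip i j i<n j<n with position i j
  ... | at-topLeft refl refl rewrite flipTile-topLeft (tileAt (rothe w) i₀ j₀) = sym H′-topLeft
  ... | at-topRight refl refl rewrite flipTile-topRight (tileAt (rothe w) i₀ j₁) with W i₀ ≟ j₁
  ...   | yes e rewrite dec-true (W i₀ ≟ j₁) e = sym (H′-true (λ e′ → contradiction (sym e′) i₁≢i₀) (≤-reflexive e))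
  ...   | no ne rewrite dec-false (W i₀ ≟ j₁) ne = sym (H′-false (λ _ → j₁≢j₀) (≤∧≢⇒< 1+j₀≤W[i₀] (ne ∘ sym)))
  segE-flip i j i<n j<n | at-bottomLeft refl refl rewrite flipTile-bottomLeft (tileAt (rothe w) i₁ j₀) with W i₁ ≟ j₀
  ...   | yes e rewrite dec-true (W i₁ ≟ j₀) e = sym H′-bottomLeft
  ...   | no ne rewrite dec-false (W i₁ ≟ j₀) ne = sym H′-bottomLeft
  segE-flip i j i<n j<n | at-bottomRight refl refl rewrite flipTile-bottomRight (tileAt (rothe w) i₁ j₁) =
    sym (H′-true (λ _ → j₁≢j₀) (≤-trans W[1+i₀]≤j₀ (n≤1+n j₀)))
  segE-flip i j i<n j<n | outside out rewrite flipTile-outside (tileAt (rothe w) i j) out =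
    trans (RotheSegments.east i j i<n j<n)
      (sym (H′-elsewhere (λ (a , b) → out (inj₁ (cong suc a) , inj₁ (cong suc b)))
                         (λ (a , b) → out (inj₂ a , inj₁ (cong suc b)))))

  segS-flip : ∀ i j → i < n → j < n → segS (flipTile i j (tileAt (rothe w) i j)) ≡ V′ i j
  segS-flip i j i<n j<n with position i j
  ... | at-topLeft refl refl rewrite flipTile-topLeft (tileAt (rothe w) i₀ j₀) = sym V′-topLeft
  ... | at-topRight refl refl rewrite flipTile-topRight (tileAt (rothe w) i₀ j₁) with W i₀ ≟ j₁
  ...   | yes e rewrite dec-true (W i₀ ≟ j₁) e = sym V′-topRight
  ...   | no ne rewrite dec-false (W i₀ ≟ j₁) ne = sym V′-topRight
  segS-flip i j i<n j<n | at-bottomLeft refl refl rewrite flipTile-bottomLeft (tileAt (rothe w) i₁ j₀) with W i₁ ≟ j₀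
  ...   | yes e rewrite dec-true (W i₁ ≟ j₀) e =
    sym (V′-true (λ e′ _ → j₁≢j₀ (sym e′)) (≤-reflexive (trans (cong V (sym e)) V[W[i₁]]≡i₁)))
  ...   | no ne rewrite dec-false (W i₁ ≟ j₀) ne =
    sym (V′-false (λ e′ → contradiction e′ i₁≢i₀) (≤∧≢⇒< i₀<V[j₀] (λ e′ → ne (trans (cong W e′) (W∘V j₀<n)))))
  segS-flip i j i<n j<n | at-bottomRight refl refl rewrite flipTile-bottomRight (tileAt (rothe w) i₁ j₁) =
    sym (V′-true (λ _ → i₁≢i₀) (<⇒≤ r<i₁))
  segS-flip i j i<n j<n | outside out rewrite flipTile-outside (tileAt (rothe w) i j) out =
    trans (RotheSegments.south i j i<n j<n)
      (sym (V′-elsewhere (λ (a , b) → out (inj₁ (cong suc a) , inj₁ (cong suc b)))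
                         (λ (a , b) → out (inj₁ (cong suc a) , inj₂ b))))

  segN-flip : ∀ i j → i < n → j < n → segN (flipTile i j (tileAt (rothe w) i j)) ≡ fromAbove V′ i j
  segN-flip i j i<n j<n with position i j
  ... | at-topLeft refl refl rewrite flipTile-topLeft (tileAt (rothe w) i₀ j₀) = sym ¬above-topLeft
  ... | at-topRight refl refl rewrite flipTile-topRight (tileAt (rothe w) i₀ j₁) with W i₀ ≟ j₁
  ...   | yes e rewrite dec-true (W i₀ ≟ j₁) e =
    sym (fromAbove-V′-false i₀ j₁ (λ e′ → contradiction (sym e′) i₁≢i₀) (≤-reflexive (sym (W[i₀]≡j₁⇒r≡i₀ e))))
  ...   | no ne rewrite dec-false (W i₀ ≟ j₁) ne = sym (row-above i₀ (r<i₀ ne) ≤-refl)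
    where
    row-above : ∀ i → r < i → i ≤ i₀ → fromAbove V′ i j₁ ≡ true
    row-above (suc t) (s≤s r≤t) t<i₀ = V′-true (λ _ → <⇒≢ t<i₀) r≤t
  segN-flip i j i<n j<n | at-bottomLeft refl refl rewrite flipTile-bottomLeft (tileAt (rothe w) i₁ j₀) with W i₁ ≟ j₀
  ...   | yes e rewrite dec-true (W i₁ ≟ j₀) e = sym V′-topLeft
  ...   | no ne rewrite dec-false (W i₁ ≟ j₀) ne = sym V′-topLeft
  segN-flip i j i<n j<n | at-bottomRight refl refl rewrite flipTile-bottomRight (tileAt (rothe w) i₁ j₁) =
    sym V′-topRight
  segN-flip i j i<n j<n | outside out rewrite flipTile-outside (tileAt (rothe w) i j) out =
    trans (RotheSegments.north i j i<n j<n) (unchanged i out)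
    where
    unchanged : ∀ i → Outside i j → fromAbove rotheV i j ≡ fromAbove V′ i j
    unchanged zero _ = refl
    unchanged (suc t) out′ = sym (V′-elsewhere (λ (a , b) → out′ (inj₂ (cong suc a) , inj₁ (cong suc b)))
                                                (λ (a , b) → out′ (inj₂ (cong suc a) , inj₂ b)))

  segW-flip : ∀ i j → i < n → j < n → segW (flipTile i j (tileAt (rothe w) i j)) ≡ fromLeft H′ i j
  segW-flip i j i<n j<n with position i j
  ... | at-topLeft refl refl rewrite flipTile-topLeft (tileAt (rothe w) i₀ j₀) =
    sym (fromLeft-H′-false i₀ j₀ (λ _ e → j₁≢j₀ (sym e)) (≤-trans (n≤1+n j₀) 1+j₀≤W[i₀]))
  ... | at-topRight refl refl rewrite flipTile-topRight (tileAt (rothe w) i₀ j₁) with W i₀ ≟ j₁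
  ...   | yes e rewrite dec-true (W i₀ ≟ j₁) e = sym H′-topLeft
  ...   | no ne rewrite dec-false (W i₀ ≟ j₁) ne = sym H′-topLeft
  segW-flip i j i<n j<n | at-bottomLeft refl refl rewrite flipTile-bottomLeft (tileAt (rothe w) i₁ j₀) with W i₁ ≟ j₀
  ...   | yes e rewrite dec-true (W i₁ ≟ j₀) e =
    sym (fromLeft-H′-false i₁ j₀ (λ e′ → contradiction e′ i₁≢i₀) (≤-reflexive (sym e)))
  ...   | no ne rewrite dec-false (W i₁ ≟ j₀) ne = sym (fromLeft-H′-row-i₁ j₀ (W[i₁]<j₀ ne) ≤-refl)
  segW-flip i j i<n j<n | at-bottomRight refl refl rewrite flipTile-bottomRight (tileAt (rothe w) i₁ j₁) =
    sym H′-bottomLeft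
  segW-flip i j i<n j<n | outside out rewrite flipTile-outside (tileAt (rothe w) i j) out =
    trans (RotheSegments.west i j i<n j<n) (unchanged j out)
    where
    unchanged : ∀ j → Outside i j → fromLeft rotheH i j ≡ fromLeft H′ i j
    unchanged zero _ = refl
    unchanged (suc t) out′ = sym (H′-elsewhere (λ (a , b) → out′ (inj₁ (cong suc a) , inj₂ (cong suc b)))
                                                (λ (a , b) → out′ (inj₂ a , inj₂ (cong suc b))))

  D′-segments : Segments D′ H′ V′
  D′-segments = record
    { east  = λ i j i<n j<n → trans (cong segE (tileAt-D′ i j i<n j<n)) (segE-flip i j i<n j<n)
    ; south = λ i j i<n j<n → trans (cong segS (tileAt-D′ i j i<n j<n)) (segS-flip i j i<n j<n)
    ; north = λ i j i<n j<n → trans (cong segN (tileAt-D′ i j i<n j<n)) (segN-flip i j i<n j<n)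
    ; west  = λ i j i<n j<n → trans (cong segW (tileAt-D′ i j i<n j<n)) (segW-flip i j i<n j<n) }

  D′-isBPD : IsBPD D′
  D′-isBPD = segments-isBPD D′-segments
    (λ j j<n → V′-true (λ _ → >⇒≢ (<⇒≤∸1 1+i₀<n)) (<⇒≤∸1 (V<n j<n)))
    (λ i i<n → H′-true (λ _ → >⇒≢ (<⇒≤∸1 1+j₀<n)) (<⇒≤∸1 (W<n i<n)))

  open Tracing D′ D′-segments

  reach-bottom : ∀ {x c z} → x < n → c < n → (∀ s → x ≤ s → V′ s c ≡ true) →
    Reach x c fromS z → Reach (n ∸ 1) c fromS z
  reach-bottom x<n c<n column = reach-column (<⇒≤∸1 x<n) (m<n⇒n∸1<n x<n) c<n (λ s x≤s _ → column s x≤s)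

  pipe-unmoved : ∀ x → x < n → x ≢ r → x ≢ i₁ → Reach (n ∸ 1) (W x) fromS x
  pipe-unmoved x x<n x≢r x≢i₁ =
    reach-bottom x<n W[x]<n (λ s x≤s → V′-true outside-j₁ (subst (_≤ s) (sym V[W[x]]≡x) x≤s))
      (reach-corner-exit x<n W[x]<n (V′-true outside-j₁ (≤-reflexive V[W[x]]≡x))
        (fromAbove-V′-false x (W x) (λ e → contradiction e x≢i₁) (≤-reflexive (sym V[W[x]]≡x)))
        (λ t W[x]≤t _ → H′-true (λ e → contradiction e x≢i₁) W[x]≤t))
    where
    W[x]<n = W<n x<n
    V[W[x]]≡x : V (W x) ≡ x
    V[W[x]]≡x = V∘W x<n
    outside-j₁ : ∀ {s} → W x ≡ j₁ → s ≢ i₀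
    outside-j₁ e _ = x≢r (trans (sym V[W[x]]≡x) (cong V e))

  pipe-into-row-i₁ : Reach (n ∸ 1) j₁ fromS i₁
  pipe-into-row-i₁ =
    reach-bottom 1+i₀<n 1+j₀<n (λ s i₁≤s → V′-true (λ _ → >⇒≢ i₁≤s) (≤-trans (<⇒≤ r<i₁) i₁≤s))
      (reach-corner-exit 1+i₀<n 1+j₀<n (V′-true (λ _ → i₁≢i₀) (<⇒≤ r<i₁)) V′-topRight
        (λ t j₁≤t _ → H′-true (λ _ → >⇒≢ j₁≤t) (≤-trans W[1+i₀]≤j₀ (≤-trans (n≤1+n j₀) j₁≤t))))

  pipe-from-topLeft : Reach i₀ j₀ fromS r
  pipe-from-topLeft with W i₀ ≟ j₁
  ... | yes W[i₀]≡j₁ =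
    subst (Reach i₀ j₀ fromS) (sym (W[i₀]≡j₁⇒r≡i₀ W[i₀]≡j₁))
      (reach-corner-exit i₀<n j₀<n V′-topLeft ¬above-topLeft east)
    where
    east : ∀ t → j₀ ≤ t → t < n → H′ i₀ t ≡ true
    east t j₀≤t _ with m≤n⇒m<n∨m≡n j₀≤t
    ... | inj₂ refl = H′-topLeft
    ... | inj₁ j₀<t = H′-true (λ e → contradiction (sym e) i₁≢i₀) (subst (_≤ t) (sym W[i₀]≡j₁) j₀<t)
  ... | no W[i₀]≢j₁ = reach-turn-east i₀<n 1+j₀<n V′-topLeft ¬above-topLeft (up-column-j₁ i₀ refl (r<i₀ W[i₀]≢j₁))
    where
    corner : Reach r j₁ fromS r
    corner = reach-corner-exit r<n 1+j₀<n (V′-true (λ _ → <⇒≢ (r<i₀ W[i₀]≢j₁)) ≤-refl)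
      (fromAbove-V′-false r j₁ (λ e → contradiction e (<⇒≢ r<i₁)) ≤-refl)
      (λ t j₁≤t _ → H′-true (λ e → contradiction e (<⇒≢ r<i₁)) (subst (_≤ t) (sym W[r]≡j₁) j₁≤t))
    up-column-j₁ : ∀ i → i ≡ i₀ → r < i → Reach i j₁ fromW r
    up-column-j₁ (suc p) 1+p≡i₀ (s≤s r≤p) =
      reach-turn-north (subst (_< n) (sym 1+p≡i₀) i₀<n) 1+j₀<n
        (subst (λ z → H′ z j₀ ≡ true) (sym 1+p≡i₀) H′-topLeft)
        (H′-false (λ _ → j₁≢j₀) (subst (λ z → j₁ < W z) (sym 1+p≡i₀) (≤∧≢⇒< 1+j₀≤W[i₀] (W[i₀]≢j₁ ∘ sym))))
        (reach-column r≤p (<-trans (subst (p <_) 1+p≡i₀ ≤-refl) i₀<n) 1+j₀<n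
          (λ s r≤s s≤p → V′-true (λ _ → <⇒≢ (subst (s <_) 1+p≡i₀ (s≤s s≤p))) r≤s) corner)

  pipe-into-row-r : Reach (n ∸ 1) (W i₁) fromS r
  pipe-into-row-r with W i₁ ≟ j₀
  ... | yes W[i₁]≡j₀ =
    subst (λ c → Reach (n ∸ 1) c fromS r) (sym W[i₁]≡j₀) (reach-bottom i₀<n j₀<n down pipe-from-topLeft)
    where
    down : ∀ s → i₀ ≤ s → V′ s j₀ ≡ true
    down s i₀≤s with m≤n⇒m<n∨m≡n i₀≤s
    ... | inj₂ refl = V′-topLeft
    ... | inj₁ i₀<s = V′-true (λ e → contradiction (sym e) j₁≢j₀)
                              (subst (_≤ s) (sym (trans (cong V (sym W[i₁]≡j₀)) V[W[i₁]]≡i₁)) i₀<s)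
  ... | no W[i₁]≢j₀ =
    reach-bottom 1+i₀<n c₀<n (λ s i₁≤s → V′-true (λ e → contradiction e c₀≢j₁) (subst (_≤ s) (sym V[W[i₁]]≡i₁) i₁≤s))
      (reach-turn-east 1+i₀<n (≤-<-trans c₀<j₀ j₀<n) (V′-true (λ e → contradiction e c₀≢j₁) (≤-reflexive V[W[i₁]]≡i₁))
        (V′-false (λ _ → <⇒≢ c₀<j₀) (subst (i₀ <_) (sym V[W[i₁]]≡i₁) ≤-refl))
        (reach-row 1+i₀<n c₀<j₀ j₀<n
          (λ t c₀<t t<j₀ → fromLeft-H′-row-i₁ t c₀<t (<⇒≤ t<j₀) , H′-true (λ _ → <⇒≢ t<j₀) (<⇒≤ c₀<t))
          (reach-turn-north 1+i₀<n j₀<n (fromLeft-H′-row-i₁ j₀ c₀<j₀ ≤-refl) H′-bottomLeft pipe-from-topLeft)))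
    where
    c₀<j₀ : W i₁ < j₀
    c₀<j₀ = W[i₁]<j₀ W[i₁]≢j₀
    c₀<n : W i₁ < n
    c₀<n = W<n 1+i₀<n
    c₀≢j₁ : W i₁ ≢ j₁
    c₀≢j₁ = <⇒≢ (<-trans c₀<j₀ (n<1+n j₀))

  D′-at : ∀ {i j x y} → toℕ i ≡ x → toℕ j ≡ y → D′ i j ≡ flipTile x y (rothe w i j)
  D′-at refl refl = refl

  isCross-topRight : isCross topRight ≡ false
  isCross-topRight with W i₀ ≡ᵇ j₁
  ... | true = refl
  ... | false = refl

  isCross-bottomLeft : isCross bottomLeft ≡ false
  isCross-bottomLeft with W i₁ ≡ᵇ j₀
  ... | true = refl
  ... | false = refl

  isCross-D′ : ∀ i j → ¬ (toℕ i ≡ i₁ × toℕ j ≡ j₁) → isCross (D′ i j) ≡ isCross (rothe w i j)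
  isCross-D′ i j ¬br with position (toℕ i) (toℕ j)
  ... | at-topLeft a b = trans (cong isCross (trans (D′-at a b) (flipTile-topLeft _)))
    (sym (rothe-no-cross-row i j (subst₂ (λ x y → ¬ W x < y) (sym a) (sym b) (≤⇒≯ (≤-trans (n≤1+n j₀) 1+j₀≤W[i₀])))))
  ... | at-topRight a b = trans (cong isCross (trans (D′-at a b) (flipTile-topRight _)))
    (trans isCross-topRight (sym (rothe-no-cross-row i j (subst₂ (λ x y → ¬ W x < y) (sym a) (sym b) (≤⇒≯ 1+j₀≤W[i₀])))))
  ... | at-bottomLeft a b = trans (cong isCross (trans (D′-at a b) (flipTile-bottomLeft _)))
    (trans isCross-bottomLeft (sym (rothe-no-cross-column i j (subst₂ (λ x y → ¬ V y < x) (sym a) (sym b) (≤⇒≯ i₀<V[j₀])))))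
  ... | at-bottomRight a b = contradiction (a , b) ¬br
  ... | outside out = cong isCross (flipTile-outside (rothe w i j) out)

  î₁ ĵ₁ r̂ : Fin n
  î₁ = fromℕ< 1+i₀<n
  ĵ₁ = fromℕ< 1+j₀<n
  r̂ = fromℕ< r<n

  rothe-bottomRight : isCross (rothe w î₁ ĵ₁) ≡ true
  rothe-bottomRight rewrite rothe-isCross î₁ ĵ₁ | FP.toℕ-fromℕ< 1+i₀<n | FP.toℕ-fromℕ< 1+j₀<n =
    cong₂ _∧_ (<⇒<ᵇ≡true (s≤s W[1+i₀]≤j₀)) (<⇒<ᵇ≡true r<i₁)

  D′-bottomRight : D′ î₁ ĵ₁ ≡ relbow
  D′-bottomRight = trans (D′-at (FP.toℕ-fromℕ< 1+i₀<n) (FP.toℕ-fromℕ< 1+j₀<n)) (flipTile-bottomRight _)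

  removesCross : RemovesCross (rothe w) D′ j₁ i₁
  removesCross = î₁ , ĵ₁ , (inj₂ (FP.toℕ-fromℕ< 1+i₀<n) , inj₂ (FP.toℕ-fromℕ< 1+j₀<n)) ,
    isCross⇒≡cross _ rothe-bottomRight , λ e → relbow≢cross (trans (sym D′-bottomRight) e)
    where relbow≢cross : relbow ≢ cross
          relbow≢cross ()

  numCross-flip : numCross (rothe w) ≡ 1 + numCross D′
  numCross-flip = sumFin-excess₁ n _ _ î₁ 1
    (sumFin-excess₁ n _ _ ĵ₁ 1 one-less
      (λ j j≢ĵ₁ → cong b2n (sym (isCross-D′ î₁ j (λ (_ , b) → j≢ĵ₁ (toℕ≡⇒≡fromℕ< 1+j₀<n b))))))
    (λ i i≢î₁ → sumFin-cong n (λ j → cong b2n (sym (isCross-D′ i j (λ (a , _) → i≢î₁ (toℕ≡⇒≡fromℕ< 1+i₀<n a))))))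
    where one-less : b2n (isCross (rothe w î₁ ĵ₁)) ≡ 1 + b2n (isCross (D′ î₁ ĵ₁))
          one-less rewrite rothe-bottomRight | D′-bottomRight = refl

  swap : Fin n → Fin n
  swap = PC.transpose r̂ î₁

  w′ : Permutation′ n
  w′ = transpose r̂ î₁ ∘ₚ w

  r̂≢î₁ : r̂ ≢ î₁
  r̂≢î₁ e = <⇒≢ r<i₁ (trans (sym (FP.toℕ-fromℕ< r<n)) (trans (cong toℕ e) (FP.toℕ-fromℕ< 1+i₀<n)))

  swap-r̂ : swap r̂ ≡ î₁
  swap-r̂ rewrite dec-true (r̂ F.≟ r̂) refl = refl

  swap-î₁ : swap î₁ ≡ r̂
  swap-î₁ rewrite dec-false (î₁ F.≟ r̂) (r̂≢î₁ ∘ sym) | dec-true (î₁ F.≟ î₁) refl = refl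

  swap-other : ∀ {k} → k ≢ r̂ → k ≢ î₁ → swap k ≡ k
  swap-other {k} k≢r̂ k≢î₁ rewrite dec-false (k F.≟ r̂) k≢r̂ | dec-false (k F.≟ î₁) k≢î₁ = refl

  w[î₁] : toℕ (w ⟨$⟩ʳ î₁) ≡ W i₁
  w[î₁] = trans (sym (W-toℕ î₁)) (cong W (FP.toℕ-fromℕ< 1+i₀<n))

  w[r̂] : toℕ (w ⟨$⟩ʳ r̂) ≡ j₁
  w[r̂] = trans (sym (W-toℕ r̂)) (trans (cong W (FP.toℕ-fromℕ< r<n)) W[r]≡j₁)

  exits-via : ∀ {x y c z} → swap x ≡ y → toℕ (w ⟨$⟩ʳ y) ≡ c → z ≡ toℕ x →
    Reach (n ∸ 1) c fromS z → exitRow D′ (toℕ (w′ ⟨$⟩ʳ x)) ≡ just (toℕ x)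
  exits-via refl refl refl R = exitRow-reach R

  boundary : HasBoundaryPerm D′ w′
  boundary x = exits (x F.≟ r̂) (x F.≟ î₁)
    where
    toℕ-≡ : ∀ {y} (y<n : y < n) → x ≡ fromℕ< y<n → y ≡ toℕ x
    toℕ-≡ y<n e = trans (sym (FP.toℕ-fromℕ< y<n)) (cong toℕ (sym e))
    exits : Dec (x ≡ r̂) → Dec (x ≡ î₁) → exitRow D′ (toℕ (w′ ⟨$⟩ʳ x)) ≡ just (toℕ x)
    exits (yes x≡r̂) _ = exits-via (trans (cong swap x≡r̂) swap-r̂) w[î₁] (toℕ-≡ r<n x≡r̂) pipe-into-row-r
    exits (no _) (yes x≡î₁) = exits-via (trans (cong swap x≡î₁) swap-î₁) w[r̂] (toℕ-≡ 1+i₀<n x≡î₁) pipe-into-row-i₁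
    exits (no x≢r̂) (no x≢î₁) = exits-via (swap-other x≢r̂ x≢î₁) (sym (W-toℕ x)) refl
      (pipe-unmoved (toℕ x) (FP.toℕ<n x) (x≢r̂ ∘ toℕ≡⇒≡fromℕ< r<n) (x≢î₁ ∘ toℕ≡⇒≡fromℕ< 1+i₀<n))

  inv-flip : inv w ≡ 1 + inv w′
  inv-flip = inversions-exchange n (λ x → toℕ (w ⟨$⟩ʳ x)) (λ x → toℕ (w′ ⟨$⟩ʳ x)) r̂ î₁
    (subst₂ _<_ (sym (FP.toℕ-fromℕ< r<n)) (sym (FP.toℕ-fromℕ< 1+i₀<n)) r<i₁)
    (subst₂ _<_ (sym w[î₁]) (sym w[r̂]) (s≤s W[1+i₀]≤j₀))
    (cong (λ z → toℕ (w ⟨$⟩ʳ z)) swap-r̂)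
    (cong (λ z → toℕ (w ⟨$⟩ʳ z)) swap-î₁)
    (λ k k≢r̂ k≢î₁ → cong (λ z → toℕ (w ⟨$⟩ʳ z)) (swap-other k≢r̂ k≢î₁))
    gap
    where
    gap : ∀ k → toℕ r̂ < toℕ k → toℕ k < toℕ î₁ →
      toℕ (w ⟨$⟩ʳ k) < toℕ (w ⟨$⟩ʳ î₁) ⊎ toℕ (w ⟨$⟩ʳ r̂) < toℕ (w ⟨$⟩ʳ k)
    gap k r<k k<i₁ rewrite w[î₁] | w[r̂] | sym (W-toℕ k) =
      between (toℕ k) (subst (_< toℕ k) (FP.toℕ-fromℕ< r<n) r<k) (subst (toℕ k <_) (FP.toℕ-fromℕ< 1+i₀<n) k<i₁)

  reduced : Reduced D′ w′
  reduced = suc-injective (trans (sym numCross-flip) (trans numCross-rothe inv-flip))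

  -- Row i₀ of V′ gains the segment at j₀ and loses the one at j₁ = j₀ + 1.
  countBelow-row-i₀ : ∀ a → countBelow a (V′ i₀) ≡ countBelow a (rotheV i₀) + b2n (a ≡ᵇ j₁)
  countBelow-row-i₀ zero = refl
  countBelow-row-i₀ (suc a) = extend a (countBelow-row-i₀ a)
    where
    extend : ∀ a → countBelow a (V′ i₀) ≡ countBelow a (rotheV i₀) + b2n (a ≡ᵇ j₁) →
      countBelow (suc a) (V′ i₀) ≡ countBelow (suc a) (rotheV i₀) + b2n (suc a ≡ᵇ j₁)
    extend a ih with a ≟ j₀ | a ≟ j₁
    ... | yes refl | _
      rewrite ih | V′-topLeft | dec-false (V j₀ ≤? i₀) (<⇒≱ i₀<V[j₀])
            | dec-false (j₀ ≟ j₁) (j₁≢j₀ ∘ sym) | dec-true (j₁ ≟ j₁) refl = refl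
    ... | no _ | yes refl
      rewrite ih | V′-topRight | dec-true (V j₁ ≤? i₀) V[1+j₀]≤i₀
            | dec-true (j₁ ≟ j₁) refl | dec-false (suc j₁ ≟ j₁) (>⇒≢ (n<1+n j₁)) = refl
    ... | no a≢j₀ | no a≢j₁
      rewrite ih | V′-elsewhere {i₀} {a} (a≢j₀ ∘ proj₂) (a≢j₁ ∘ proj₂)
            | dec-false (a ≟ j₁) a≢j₁ | dec-false (suc a ≟ j₁) (a≢j₀ ∘ suc-injective) =
      trans (cong (_+ b2n (rotheV i₀ a)) (+-identityʳ _)) (sym (+-identityʳ _))

  heights-elsewhere : ∀ a b → a ≤ n → b ≤ n → ¬ (a ≡ j₁ × b ≡ i₁) → height D′ a b ≡ height (rothe w) a b
  heights-elsewhere a zero _ _ _ = refl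
  heights-elsewhere a (suc b) a≤n b<n ¬flip with b ≟ i₀
  ... | no b≢i₀ = trans (height-segments D′-segments a b a≤n b<n)
    (trans (countBelow-cong a (λ j _ → V′-elsewhere (b≢i₀ ∘ proj₁) (b≢i₀ ∘ proj₁)))
      (sym (height-segments rothe-segments a b a≤n b<n)))
  ... | yes refl = begin
    height D′ a i₁                                    ≡⟨ height-segments D′-segments a i₀ a≤n b<n ⟩
    countBelow a (V′ i₀)                              ≡⟨ countBelow-row-i₀ a ⟩
    countBelow a (rotheV i₀) + b2n (a ≡ᵇ j₁)
      ≡⟨ cong (λ b → countBelow a (rotheV i₀) + b2n b) (dec-false (a ≟ j₁) (λ e → ¬flip (e , refl))) ⟩
    countBelow a (rotheV i₀) + 0                      ≡⟨ +-identityʳ _ ⟩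
    countBelow a (rotheV i₀)                          ≡⟨ sym (height-segments rothe-segments a i₀ a≤n b<n) ⟩
    height (rothe w) a i₁                             ∎
    where open ≡-Reasoning

  height-at-flip : height D′ j₁ i₁ ≡ suc (height (rothe w) j₁ i₁)
  height-at-flip = begin
    height D′ j₁ i₁                                   ≡⟨ height-segments D′-segments j₁ i₀ (<⇒≤ 1+j₀<n) i₀<n ⟩
    countBelow j₁ (V′ i₀)                             ≡⟨ countBelow-row-i₀ j₁ ⟩
    countBelow j₁ (rotheV i₀) + b2n (j₁ ≡ᵇ j₁)
      ≡⟨ cong (λ b → countBelow j₁ (rotheV i₀) + b2n b) (dec-true (j₁ ≟ j₁) refl) ⟩
    countBelow j₁ (rotheV i₀) + 1                     ≡⟨ +-comm _ 1 ⟩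
    suc (countBelow j₁ (rotheV i₀))                   ≡⟨ cong suc (sym (height-segments rothe-segments j₁ i₀ (<⇒≤ 1+j₀<n) i₀<n)) ⟩
    suc (height (rothe w) j₁ i₁)                      ∎
    where open ≡-Reasoning

  isFlip : IsFlip (rothe w) D′ j₁ i₁
  isFlip = s≤s z≤n , 1+j₀<n , s≤s z≤n , 1+i₀<n , D′-isBPD ,
    (λ i j out → flipTile-outside (rothe w i j) out) , heights-elsewhere , inj₁ height-at-flip

lemma5p3 : ∀ (n : ℕ) (w : Permutation′ n) → ¬ (∀ i → w ⟨$⟩ʳ i ≡ i) →
    ∃[ a ] ∃[ b ] ∃[ D′ ] ∃[ w′ ]
      (IsFlip (rothe w) D′ a b × RemovesCross (rothe w) D′ a b ×
       HasBoundaryPerm D′ w′ × Reduced D′ w′ × inv w′ ≡ inv w ∸ 1)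
lemma5p3 n w ¬id =
  j₁ , i₁ , D′ , w′ , isFlip , removesCross , boundary , reduced , cong (_∸ 1) (sym inv-flip)
  where open Flip w (flipSite w ¬id)
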